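{- Let $d>0$ be square-free and let $A=\begin{pmatrix}a&B\\ \bar B&c\end{pmatrix}$ with $a,c\in\mathbb{Z}$, $B\in\mathcal{O}_d$, $D=|B|^2-ac>0$, correspond to an embedded totally geodesic surface in $\Omega_d$. Then $$4D\le\min_{x,y\in\mathcal{O}_d:\ Q_A(x,y)\neq0}Q_A(x,y)^2,$$ where $Q_A(x,y)=\begin{pmatrix}x&y\end{pmatrix}A\begin{pmatrix}\bar x\\ \bar y\end{pmatrix}$.
   Context: $\mathcal{O}_d$ is the ring of integers of $\mathbb{Q}(\sqrt{ -d})$, $\Gamma_d=\mathrm{PSL}(2,\mathcal{O}_d)$, $\Omega_d=\mathbb{H}^3/\Gamma_d$. $A$ corresponds to the image in $\Omega_d$ of the hyperbolic plane $H$ bounded by the circle (or line) $a|z|^2+Bz+\bar B\bar z+c=0$; it is embedded if for all $\gamma\in\Gamma_d$, either $\gamma H=H$ or $\gamma H\cap H=\emptyset$. -}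

module Defs where

open import Data.Nat as ℕ using (ℕ)
open import Data.Nat.Divisibility using (_∣_)
open import Data.Integer as ℤ using (ℤ)
open import Data.Rational using (ℚ; 0ℚ; 1ℚ; _+_; _*_; -_; _-_; _<_; _≤_; _/_)
open import Data.Product using (_×_; Σ; ∃; ∃-syntax)
open import Relation.Binary.PropositionalEquality using (_≡_)
open import Function.Bundles using (_⇔_)
open import Relation.Nullary using (¬_)
open import Data.Sum using (_⊎_)

SquareFree : ℕ → Set
SquareFree d = ∀ (p : ℕ) → (p ℕ.* p) ∣ d → p ≡ 1

-- The field K = ℚ(√-d):  an element  re + im·√-d  with re, im ∈ ℚ.
-- The parameter d is the (positive, square-free) integer of the paper.

record K : Set where
  constructor _+√-d·_
  field
    re im : ℚ
open K public

ℤ→ℚ : ℤ → ℚ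
ℤ→ℚ n = n / 1

module Field (d : ℕ) where
  dℚ : ℚ
  dℚ = ℤ→ℚ (ℤ.+ d)

  infixl 6 _⊕_
  infixl 7 _⊗_
  _⊕_ : K → K → K
  (a +√-d· b) ⊕ (c +√-d· e) = (a + c) +√-d· (b + e)

  _⊗_ : K → K → K
  (a +√-d· b) ⊗ (c +√-d· e) = (a * c - dℚ * (b * e)) +√-d· (a * e + b * c)

  ι : ℚ → K
  ι q = q +√-d· 0ℚ

  conj : K → K
  conj (a +√-d· b) = a +√-d· (- b)

  N : K → ℚ
  N (a +√-d· b) = a * a + dℚ * (b * b)

  Tr : K → ℚ
  Tr (a +√-d· b) = a + a

  IsIntegerℚ : ℚ → Set
  IsIntegerℚ q = ∃[ n ] q ≡ ℤ→ℚ n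

  -- z lies in the ring of integers 𝒪_d: z is an algebraic integer, i.e.
  -- its minimal polynomial X² - Tr(z) X + N(z) has integer coefficients.
  In𝒪 : K → Set
  In𝒪 z = IsIntegerℚ (Tr z) × IsIntegerℚ (N z)

  -- Γ_d = PSL(2, 𝒪_d).  We work with SL(2, 𝒪_d); ±γ act identically on
  -- ℍ³, so quantifying over SL(2,𝒪_d) is the same as over PSL(2,𝒪_d).

  record SL2 : Set where
    field
      α β γ δ : K
      α∈ : In𝒪 α
      β∈ : In𝒪 β
      γ∈ : In𝒪 γ
      δ∈ : In𝒪 δ
      det≡1 : (α ⊗ δ) ⊕ (ι (- 1ℚ) ⊗ (β ⊗ γ)) ≡ ι 1ℚ

  -- Points of upper half-space ℍ³ = {(z,t) : z ∈ ℂ, t > 0}, recorded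
  -- as (z, s) with s = t².  We use the points with z ∈ K and s ∈ ℚ.

  record Pt : Set where
    field
      z : K
      s : ℚ
      s>0 : 0ℚ < s

  -- The hyperbolic plane H_A bounded by a|z|² + Bz + B̄z̄ + c = 0:
  -- the points (z,t) with a(|z|² + t²) + Bz + B̄z̄ + c = 0.
  plane-eq : ℤ → K → ℤ → K → ℚ → ℚ
  plane-eq a B c z s = ℤ→ℚ a * (N z + s) + Tr (B ⊗ z) + ℤ→ℚ c

  _∈H[_,_,_] : Pt → ℤ → K → ℤ → Set
  p ∈H[ a , B , c ] = plane-eq a B c (Pt.z p) (Pt.s p) ≡ 0ℚ

  -- Action of g = (α β; γ δ) on ℍ³:
  --   g·(z,t) = ( X / Nd , t / Nd ),
  --   X  = (αz+β)·conj(γz+δ) + α·conj(γ)·t²,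
  --   Nd = |γz+δ|² + |γ|² t²   (> 0).
  -- "g·p ∈ H_A" is the plane equation at g·p multiplied by Nd² > 0:
  --   a(|X|² + t²) + Nd·(BX + conj(BX)) + c·Nd² = 0.
  _·_∈H[_,_,_] : SL2 → Pt → ℤ → K → ℤ → Set
  g · p ∈H[ a , B , c ] =
    ℤ→ℚ a * (N X + s) + Nd * Tr (B ⊗ X) + ℤ→ℚ c * (Nd * Nd) ≡ 0ℚ
    where
      open SL2 g
      z = Pt.z p
      s = Pt.s p
      X  = ((α ⊗ z) ⊕ β) ⊗ (conj ((γ ⊗ z) ⊕ δ)) ⊕ ((α ⊗ conj γ) ⊗ ι s)
      Nd = N ((γ ⊗ z) ⊕ δ) + N γ * s

  Preserves : SL2 → ℤ → K → ℤ → Set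
  Preserves g a B c = ∀ (p : Pt) → (p ∈H[ a , B , c ]) ⇔ (g · p ∈H[ a , B , c ])

  Disjoint : SL2 → ℤ → K → ℤ → Set
  Disjoint g a B c = ¬ (Σ Pt λ p → p ∈H[ a , B , c ] × g · p ∈H[ a , B , c ])

  Embedded : ℤ → K → ℤ → Set
  Embedded a B c = ∀ (g : SL2) → Preserves g a B c ⊎ Disjoint g a B c

  Disc : ℤ → K → ℤ → ℚ
  Disc a B c = N B - ℤ→ℚ a * ℤ→ℚ c

  -- Q_A(x,y) = (x y) A (x̄ ȳ)ᵀ = a|x|² + x B ȳ + y B̄ x̄ + c|y|²
  QA : ℤ → K → ℤ → K → K → ℚ
  QA a B c x y = ℤ→ℚ a * N x + Tr ((x ⊗ B) ⊗ conj y) + ℤ→ℚ c * N y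

module Submission where

-- If q = Q_A(x, y) ≠ 0 and q² < 4D, some g ∈ SL(2, 𝒪_d) satisfies gH ≠ H and gH ∩ H ≠ ∅: for y ≠ 0 the
-- parabolic element fixing the cusp x/y, for y = 0 the translation by x². A point (z, t) has g·(z, t) ∈ H
-- iff Q_A(g (z, 1)ᵀ) + t² Q_A(g (1, 0)ᵀ) = 0. There is a family of points p_h ∈ H, one for each rational h
-- with h² < D, on which this expression is a nonzero multiple of q − 2h. Hence g moves p_0 off H
-- (p_0 exists because D > 0) and keeps p_{q/2} on H (p_{q/2} exists because q²/4 < D).
-- Membership of g in SL(2, 𝒪_d) rests on 𝒪_d being closed under products: Tr(xy) is a root of the integral
-- monic polynomial X² − Tr x Tr y X + (N y Tr x² + N x Tr y²), so it is an integer.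

open import Defs
open import Data.Nat using (ℕ; suc)
import Data.Nat as ℕ
import Data.Nat.Properties as ℕ
open import Data.Nat.Coprimality as Coprime using (coprime-divisor)
open import Data.Nat.Divisibility using (divides; ∣-refl) renaming (_∣_ to _ℕ∣_)
open import Data.Integer using (ℤ; ∣_∣)
import Data.Integer as ℤ
import Data.Integer.Properties as ℤ
import Data.Integer.Tactic.RingSolver as ℤ-Solver
open import Data.Rational
  using (ℚ; mkℚ; 0ℚ; 1ℚ; ½; _+_; _*_; -_; _-_; _÷_; 1/_; _≤_; _<_; ↥_; ↧_; toℚᵘ; fromℚᵘ; NonZero; ≢-nonZero)
import Data.Rational as ℚ
import Data.Rational.Properties as ℚ
open import Data.Rational.Unnormalised using (mkℚᵘ; *≡*) renaming (_≃_ to _≃ᵘ_)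
import Data.Rational.Unnormalised as ℚᵘ
import Data.Rational.Unnormalised.Properties as ℚᵘ
open import Data.Product using (Σ; ∃-syntax; _×_; _,_; proj₁)
open import Data.Sum using (inj₁; inj₂; [_,_]′)
open import Function.Bundles using (_⇔_; mk⇔; Equivalence)
open import Level using (0ℓ)
open import Relation.Binary.Definitions using (tri<; tri≈; tri>)
open import Relation.Binary.PropositionalEquality
open import Relation.Nullary using (¬_; contradiction; Dec; yes; no)
open import Relation.Nullary.Decidable using (decidable-stable; dec⇒maybe)
open import Tactic.RingSolver using (solve-∀)
open import Tactic.RingSolver.Core.AlmostCommutativeRing using (AlmostCommutativeRing; fromCommutativeRing)

ℚ-ring : AlmostCommutativeRing 0ℓ 0ℓ
ℚ-ring = fromCommutativeRing ℚ.+-*-commutativeRing λ p → dec⇒maybe (0ℚ ℚ.≟ p)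

toℚᵘ-ℤ→ℚ : ∀ i → toℚᵘ (ℤ→ℚ i) ≃ᵘ mkℚᵘ i 0
toℚᵘ-ℤ→ℚ i = ℚ.toℚᵘ-fromℚᵘ (mkℚᵘ i 0)

ℤ→ℚ-+ : ∀ m n → ℤ→ℚ (m ℤ.+ n) ≡ ℤ→ℚ m + ℤ→ℚ n
ℤ→ℚ-+ m n = ℚ.toℚᵘ-injective (begin
  toℚᵘ (ℤ→ℚ (m ℤ.+ n))              ≈⟨ toℚᵘ-ℤ→ℚ (m ℤ.+ n) ⟩
  mkℚᵘ (m ℤ.+ n) 0                   ≈⟨ *≡* (cross m n) ⟩
  mkℚᵘ m 0 ℚᵘ.+ mkℚᵘ n 0             ≈⟨ ℚᵘ.+-cong (toℚᵘ-ℤ→ℚ m) (toℚᵘ-ℤ→ℚ n) ⟨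
  toℚᵘ (ℤ→ℚ m) ℚᵘ.+ toℚᵘ (ℤ→ℚ n)    ≈⟨ ℚ.toℚᵘ-homo-+ (ℤ→ℚ m) (ℤ→ℚ n) ⟨
  toℚᵘ (ℤ→ℚ m + ℤ→ℚ n)              ∎)
  where
  open ℚᵘ.≃-Reasoning
  cross : ∀ m n → (m ℤ.+ n) ℤ.* ℤ.+ 1 ≡ (m ℤ.* ℤ.+ 1 ℤ.+ n ℤ.* ℤ.+ 1) ℤ.* ℤ.+ 1
  cross = ℤ-Solver.solve-∀

ℤ→ℚ-* : ∀ m n → ℤ→ℚ (m ℤ.* n) ≡ ℤ→ℚ m * ℤ→ℚ n
ℤ→ℚ-* m n = ℚ.toℚᵘ-injective (begin
  toℚᵘ (ℤ→ℚ (m ℤ.* n))              ≈⟨ toℚᵘ-ℤ→ℚ (m ℤ.* n) ⟩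
  mkℚᵘ m 0 ℚᵘ.* mkℚᵘ n 0             ≈⟨ ℚᵘ.*-cong (toℚᵘ-ℤ→ℚ m) (toℚᵘ-ℤ→ℚ n) ⟨
  toℚᵘ (ℤ→ℚ m) ℚᵘ.* toℚᵘ (ℤ→ℚ n)    ≈⟨ ℚ.toℚᵘ-homo-* (ℤ→ℚ m) (ℤ→ℚ n) ⟨
  toℚᵘ (ℤ→ℚ m * ℤ→ℚ n)              ∎)
  where open ℚᵘ.≃-Reasoning

ℤ→ℚ-neg : ∀ m → ℤ→ℚ (ℤ.- m) ≡ - ℤ→ℚ m
ℤ→ℚ-neg m = ℚ.toℚᵘ-injective (begin
  toℚᵘ (ℤ→ℚ (ℤ.- m))                ≈⟨ toℚᵘ-ℤ→ℚ (ℤ.- m) ⟩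
  ℚᵘ.- mkℚᵘ m 0                      ≈⟨ ℚᵘ.-‿cong (toℚᵘ-ℤ→ℚ m) ⟨
  ℚᵘ.- toℚᵘ (ℤ→ℚ m)                  ≈⟨ ℚ.toℚᵘ-homo‿- (ℤ→ℚ m) ⟨
  toℚᵘ (- ℤ→ℚ m)                    ∎)
  where open ℚᵘ.≃-Reasoning

ℤ→ℚ-injective : ∀ {m n} → ℤ→ℚ m ≡ ℤ→ℚ n → m ≡ n
ℤ→ℚ-injective {m} {n} eq = ℤ.*-cancelʳ-≡ m n (ℤ.+ 1) (ℚᵘ.drop-*≡* (begin
  mkℚᵘ m 0            ≈⟨ toℚᵘ-ℤ→ℚ m ⟨
  toℚᵘ (ℤ→ℚ m)        ≡⟨ cong toℚᵘ eq ⟩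
  toℚᵘ (ℤ→ℚ n)        ≈⟨ toℚᵘ-ℤ→ℚ n ⟩
  mkℚᵘ n 0            ∎))
  where open ℚᵘ.≃-Reasoning

*-denominator≡numerator : ∀ T → T * ℤ→ℚ (↧ T) ≡ ℤ→ℚ (↥ T)
*-denominator≡numerator T@(mkℚ n m-1 _) = ℚ.toℚᵘ-injective (begin
  toℚᵘ (T * ℤ→ℚ m)              ≈⟨ ℚ.toℚᵘ-homo-* T (ℤ→ℚ m) ⟩
  toℚᵘ T ℚᵘ.* toℚᵘ (ℤ→ℚ m)      ≈⟨ ℚᵘ.*-congˡ {toℚᵘ T} (toℚᵘ-ℤ→ℚ m) ⟩
  mkℚᵘ n m-1 ℚᵘ.* mkℚᵘ m 0       ≈⟨ *≡* cross ⟩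
  mkℚᵘ n 0                       ≈⟨ toℚᵘ-ℤ→ℚ n ⟨
  toℚᵘ (ℤ→ℚ n)                  ∎)
  where
  open ℚᵘ.≃-Reasoning
  m : ℤ
  m = ℤ.+ suc m-1
  cross : (n ℤ.* m) ℤ.* ℤ.+ 1 ≡ n ℤ.* ℤ.+ (suc m-1 ℕ.* 1)
  cross rewrite ℕ.*-identityʳ m-1 = ℤ.*-identityʳ (n ℤ.* m)

monic-quadratic-root-integral : ∀ T (b c : ℤ) → T * T + ℤ→ℚ b * T + ℤ→ℚ c ≡ 0ℚ → ∃[ k ] T ≡ ℤ→ℚ k
monic-quadratic-root-integral T@(mkℚ n m-1 coprime) b c root =
  n , sym (trans (cong (λ k → fromℚᵘ (mkℚᵘ n k)) (sym m-1≡0)) (ℚ.fromℚᵘ-toℚᵘ T))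
  where
  m : ℤ
  m = ℤ.+ suc m-1
  M : ℚ
  M = ℤ→ℚ m
  k : ℤ
  k = ℤ.- (b ℤ.* n ℤ.+ c ℤ.* m)

  cleared : ℤ→ℚ (n ℤ.* n ℤ.+ b ℤ.* (n ℤ.* m) ℤ.+ c ℤ.* (m ℤ.* m)) ≡ ℤ→ℚ (ℤ.+ 0)
  cleared = begin
    ℤ→ℚ (n ℤ.* n ℤ.+ b ℤ.* (n ℤ.* m) ℤ.+ c ℤ.* (m ℤ.* m))
      ≡⟨ ℤ→ℚ-+ (n ℤ.* n ℤ.+ b ℤ.* (n ℤ.* m)) (c ℤ.* (m ℤ.* m)) ⟩
    ℤ→ℚ (n ℤ.* n ℤ.+ b ℤ.* (n ℤ.* m)) + ℤ→ℚ (c ℤ.* (m ℤ.* m))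
      ≡⟨ cong₂ _+_ (ℤ→ℚ-+ (n ℤ.* n) (b ℤ.* (n ℤ.* m))) (ℤ→ℚ-* c (m ℤ.* m)) ⟩
    ℤ→ℚ (n ℤ.* n) + ℤ→ℚ (b ℤ.* (n ℤ.* m)) + ℤ→ℚ c * ℤ→ℚ (m ℤ.* m)
      ≡⟨ cong₂ (λ u v → ℤ→ℚ (n ℤ.* n) + u + ℤ→ℚ c * v) (ℤ→ℚ-* b (n ℤ.* m)) (ℤ→ℚ-* m m) ⟩
    ℤ→ℚ (n ℤ.* n) + ℤ→ℚ b * ℤ→ℚ (n ℤ.* m) + ℤ→ℚ c * (M * M)
      ≡⟨ cong₂ (λ u v → u + ℤ→ℚ b * v + ℤ→ℚ c * (M * M)) (ℤ→ℚ-* n n) (ℤ→ℚ-* n m) ⟩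
    ℤ→ℚ n * ℤ→ℚ n + ℤ→ℚ b * (ℤ→ℚ n * M) + ℤ→ℚ c * (M * M)
      ≡⟨ cong (λ t → t * t + ℤ→ℚ b * (t * M) + ℤ→ℚ c * (M * M)) (*-denominator≡numerator T) ⟨
    T * M * (T * M) + ℤ→ℚ b * (T * M * M) + ℤ→ℚ c * (M * M)
      ≡⟨ clear-denominators T M (ℤ→ℚ b) (ℤ→ℚ c) ⟩
    (T * T + ℤ→ℚ b * T + ℤ→ℚ c) * (M * M)
      ≡⟨ cong (_* (M * M)) root ⟩
    0ℚ * (M * M)
      ≡⟨ ℚ.*-zeroˡ (M * M) ⟩
    0ℚ ∎
    where
    open ≡-Reasoning
    clear-denominators : ∀ T M b c → T * M * (T * M) + b * (T * M * M) + c * (M * M) ≡ (T * T + b * T + c) * (M * M)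
    clear-denominators = solve-∀ ℚ-ring

  n²≡km : n ℤ.* n ≡ k ℤ.* m
  n²≡km = begin
    n ℤ.* n                                                              ≡⟨ rearrange n m b c ⟩
    n ℤ.* n ℤ.+ b ℤ.* (n ℤ.* m) ℤ.+ c ℤ.* (m ℤ.* m) ℤ.+ k ℤ.* m
      ≡⟨ cong (ℤ._+ k ℤ.* m) (ℤ→ℚ-injective {m = n ℤ.* n ℤ.+ b ℤ.* (n ℤ.* m) ℤ.+ c ℤ.* (m ℤ.* m)} {n = ℤ.+ 0} cleared) ⟩
    ℤ.+ 0 ℤ.+ k ℤ.* m                                                   ≡⟨ ℤ.+-identityˡ (k ℤ.* m) ⟩
    k ℤ.* m                                                              ∎
    where
    open ≡-Reasoning
    rearrange : ∀ n m b c → n ℤ.* n ≡ n ℤ.* n ℤ.+ b ℤ.* (n ℤ.* m) ℤ.+ c ℤ.* (m ℤ.* m) ℤ.+ ℤ.- (b ℤ.* n ℤ.+ c ℤ.* m) ℤ.* m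
    rearrange = ℤ-Solver.solve-∀

  m∣n : suc m-1 ℕ∣ ∣ n ∣
  m∣n = coprime-divisor (Coprime.sym (Coprime.recompute coprime))
    (divides ∣ k ∣ (trans (sym (ℤ.abs-* n n)) (trans (cong ∣_∣ n²≡km) (ℤ.abs-* k m))))

  m-1≡0 : m-1 ≡ 0
  m-1≡0 = ℕ.suc-injective (Coprime.recompute coprime (m∣n , ∣-refl))

ℤ→ℚ-nonNeg : ∀ n → 0ℚ ≤ ℤ→ℚ (ℤ.+ n)
ℤ→ℚ-nonNeg n = ℚ.nonNegative⁻¹ (ℤ→ℚ (ℤ.+ n)) {{ℚ.normalize-nonNeg n 1}}

ℤ→ℚ-pos : ∀ {n} → 0 ℕ.< n → 0ℚ < ℤ→ℚ (ℤ.+ n)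
ℤ→ℚ-pos {suc n} _ = ℚ.positive⁻¹ (ℤ→ℚ (ℤ.+ suc n)) {{ℚ.normalize-pos (suc n) 1}}

*-nonNeg : ∀ {p q} → 0ℚ ≤ p → 0ℚ ≤ q → 0ℚ ≤ p * q
*-nonNeg {p} {q} 0≤p 0≤q =
  ℚ.nonNegative⁻¹ (p * q) {{ℚ.nonNeg*nonNeg⇒nonNeg p {{ℚ.nonNegative 0≤p}} q {{ℚ.nonNegative 0≤q}}}}

*-pos : ∀ {p q} → 0ℚ < p → 0ℚ < q → 0ℚ < p * q
*-pos {p} {q} 0<p 0<q = ℚ.positive⁻¹ (p * q) {{ℚ.pos*pos⇒pos p {{ℚ.positive 0<p}} q {{ℚ.positive 0<q}}}}

square-nonNeg : ∀ p → 0ℚ ≤ p * p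
square-nonNeg p with ℚ.≤-total 0ℚ p
... | inj₁ 0≤p = *-nonNeg 0≤p 0≤p
... | inj₂ p≤0 = ℚ.nonNegative⁻¹ (p * p) {{ℚ.nonPos*nonPos⇒nonPos p {{ℚ.nonPositive p≤0}} p {{ℚ.nonPositive p≤0}}}}

square-pos : ∀ {p} → p ≢ 0ℚ → 0ℚ < p * p
square-pos {p} p≢0 with ℚ.<-cmp p 0ℚ
... | tri< p<0 _ _ = ℚ.positive⁻¹ (p * p) {{ℚ.neg*neg⇒pos p {{ℚ.negative p<0}} p {{ℚ.negative p<0}}}}
... | tri≈ _ p≡0 _ = contradiction p≡0 p≢0
... | tri> _ _ 0<p = *-pos 0<p 0<p

nonNeg∧≢0⇒pos : ∀ {p} → 0ℚ ≤ p → p ≢ 0ℚ → 0ℚ < p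
nonNeg∧≢0⇒pos {p} 0≤p p≢0 = ℚ.positive⁻¹ p {{ℚ.nonNeg∧nonZero⇒pos p {{ℚ.nonNegative 0≤p}} {{≢-nonZero p≢0}}}}

p<q⇒0<q-p : ∀ {p q} → p < q → 0ℚ < q - p
p<q⇒0<q-p {p} {q} p<q = subst (_< q - p) (ℚ.+-inverseʳ p) (ℚ.+-monoˡ-< (- p) p<q)

4D≰q²⇒0<D-¼q² : ∀ D q → ¬ (ℤ→ℚ (ℤ.+ 4) * D ≤ q * q) → 0ℚ < D - q * ½ * (q * ½)
4D≰q²⇒0<D-¼q² D q 4D≰q² =
  subst (0ℚ <_) (sym (quarter D q)) (*-pos (p<q⇒0<q-p (ℚ.≰⇒> 4D≰q²)) (*-pos 0<½ 0<½))
  where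
  0<½ : 0ℚ < ½
  0<½ = ℚ.positive⁻¹ ½
  quarter : ∀ D q → D - q * ½ * (q * ½) ≡ (ℤ→ℚ (ℤ.+ 4) * D - q * q) * (½ * ½)
  quarter = solve-∀ ℚ-ring

*-cancelˡ-≡ : ∀ {p q r} → p ≢ 0ℚ → p * q ≡ p * r → q ≡ r
*-cancelˡ-≡ {p} {q} {r} p≢0 pq≡pr = begin
  q                 ≡⟨ cancel q ⟨
  p⁻¹ * (p * q)     ≡⟨ cong (p⁻¹ *_) pq≡pr ⟩
  p⁻¹ * (p * r)     ≡⟨ cancel r ⟩
  r                 ∎
  where
  open ≡-Reasoning
  p⁻¹ : ℚ
  p⁻¹ = (1/ p) {{≢-nonZero p≢0}}
  cancel : ∀ t → p⁻¹ * (p * t) ≡ t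
  cancel t = trans (sym (ℚ.*-assoc p⁻¹ p t))
    (trans (cong (_* t) (ℚ.*-inverseˡ p {{≢-nonZero p≢0}})) (ℚ.*-identityˡ t))

p*q≢0 : ∀ {p q} → p ≢ 0ℚ → q ≢ 0ℚ → p * q ≢ 0ℚ
p*q≢0 {p} p≢0 q≢0 pq≡0 = q≢0 (*-cancelˡ-≡ p≢0 (trans pq≡0 (sym (ℚ.*-zeroʳ p))))

÷-*-cancel : ∀ p q .{{_ : NonZero q}} → p ÷ q * q ≡ p
÷-*-cancel p q = trans (ℚ.*-assoc p (1/ q) q) (trans (cong (p *_) (ℚ.*-inverseˡ q)) (ℚ.*-identityʳ p))

module _ (d : ℕ) where
  open Field d

  infix 8 ⊝_
  infixl 6 _⊖_

  ⊝_ : K → K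
  ⊝ (u₁ +√-d· u₂) = (- u₁) +√-d· (- u₂)

  _⊖_ : K → K → K
  u ⊖ v = u ⊕ ⊝ v

  0K 1K : K
  0K = ι 0ℚ
  1K = ι 1ℚ

  -- Identities in K are checked coordinatewise by the ring solver; D stands for dℚ, which the solver
  -- can only treat as a variable.
  N-⊗ : ∀ u v → N (u ⊗ v) ≡ N u * N v
  N-⊗ (u₁ +√-d· u₂) (v₁ +√-d· v₂) = in-coordinates dℚ u₁ u₂ v₁ v₂
    where
    in-coordinates :
      ∀ D u₁ u₂ v₁ v₂ →
        (u₁ * v₁ - D * (u₂ * v₂)) * (u₁ * v₁ - D * (u₂ * v₂))
            + D * ((u₁ * v₂ + u₂ * v₁) * (u₁ * v₂ + u₂ * v₁))
        ≡ (u₁ * u₁ + D * (u₂ * u₂)) * (v₁ * v₁ + D * (v₂ * v₂))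
    in-coordinates = solve-∀ ℚ-ring

  N-⊕ : ∀ u v → N (u ⊕ v) ≡ N u + N v + Tr (u ⊗ conj v)
  N-⊕ (u₁ +√-d· u₂) (v₁ +√-d· v₂) = in-coordinates dℚ u₁ u₂ v₁ v₂
    where
    in-coordinates :
      ∀ D u₁ u₂ v₁ v₂ →
        (u₁ + v₁) * (u₁ + v₁) + D * ((u₂ + v₂) * (u₂ + v₂))
        ≡ u₁ * u₁
            + D * (u₂ * u₂)
            + (v₁ * v₁ + D * (v₂ * v₂))
            + (u₁ * v₁ - D * (u₂ * - v₂) + (u₁ * v₁ - D * (u₂ * - v₂)))
    in-coordinates = solve-∀ ℚ-ring

  Tr-⊕ : ∀ u v → Tr (u ⊕ v) ≡ Tr u + Tr v
  Tr-⊕ (u₁ +√-d· u₂) (v₁ +√-d· v₂) = in-coordinates dℚ u₁ u₂ v₁ v₂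
    where
    in-coordinates : ∀ D u₁ u₂ v₁ v₂ → u₁ + v₁ + (u₁ + v₁) ≡ u₁ + u₁ + (v₁ + v₁)
    in-coordinates = solve-∀ ℚ-ring

  N-⊝ : ∀ u → N (⊝ u) ≡ N u
  N-⊝ (u₁ +√-d· u₂) = in-coordinates dℚ u₁ u₂
    where
    in-coordinates : ∀ D u₁ u₂ → - u₁ * - u₁ + D * (- u₂ * - u₂) ≡ u₁ * u₁ + D * (u₂ * u₂)
    in-coordinates = solve-∀ ℚ-ring

  Tr-⊝ : ∀ u → Tr (⊝ u) ≡ - Tr u
  Tr-⊝ (u₁ +√-d· u₂) = in-coordinates dℚ u₁ u₂
    where
    in-coordinates : ∀ D u₁ u₂ → - u₁ + - u₁ ≡ - (u₁ + u₁)
    in-coordinates = solve-∀ ℚ-ring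

  N-conj : ∀ u → N (conj u) ≡ N u
  N-conj (u₁ +√-d· u₂) = in-coordinates dℚ u₁ u₂
    where
    in-coordinates : ∀ D u₁ u₂ → u₁ * u₁ + D * (- u₂ * - u₂) ≡ u₁ * u₁ + D * (u₂ * u₂)
    in-coordinates = solve-∀ ℚ-ring

  N-0K : N 0K ≡ 0ℚ
  N-0K = in-coordinates dℚ
    where
    in-coordinates : ∀ D → 0ℚ * 0ℚ + D * (0ℚ * 0ℚ) ≡ 0ℚ
    in-coordinates = solve-∀ ℚ-ring

  N-1K : N 1K ≡ 1ℚ
  N-1K = in-coordinates dℚ
    where
    in-coordinates : ∀ D → 1ℚ * 1ℚ + D * (0ℚ * 0ℚ) ≡ 1ℚ
    in-coordinates = solve-∀ ℚ-ring

  Tr-⊗-self : ∀ x → Tr (x ⊗ x) ≡ Tr x * Tr x - (N x + N x)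
  Tr-⊗-self (x₁ +√-d· x₂) = in-coordinates dℚ x₁ x₂
    where
    in-coordinates :
      ∀ D x₁ x₂ →
        x₁ * x₁ - D * (x₂ * x₂) + (x₁ * x₁ - D * (x₂ * x₂))
        ≡ (x₁ + x₁) * (x₁ + x₁) - (x₁ * x₁ + D * (x₂ * x₂) + (x₁ * x₁ + D * (x₂ * x₂)))
    in-coordinates = solve-∀ ℚ-ring

  Tr-⊗-root : ∀ x y →
    Tr (x ⊗ y) * Tr (x ⊗ y) + - (Tr x * Tr y) * Tr (x ⊗ y) + (N y * Tr (x ⊗ x) + N x * Tr (y ⊗ y)) ≡ 0ℚ
  Tr-⊗-root (x₁ +√-d· x₂) (y₁ +√-d· y₂) = in-coordinates dℚ x₁ x₂ y₁ y₂
    where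
    in-coordinates :
      ∀ D x₁ x₂ y₁ y₂ →
        (x₁ * y₁ - D * (x₂ * y₂) + (x₁ * y₁ - D * (x₂ * y₂))) * (x₁ * y₁ - D * (x₂ * y₂) + (x₁ * y₁ - D * (x₂ * y₂)))
            + - ((x₁ + x₁) * (y₁ + y₁)) * (x₁ * y₁ - D * (x₂ * y₂) + (x₁ * y₁ - D * (x₂ * y₂)))
            + ((y₁ * y₁ + D * (y₂ * y₂)) * (x₁ * x₁ - D * (x₂ * x₂) + (x₁ * x₁ - D * (x₂ * x₂))) + (x₁ * x₁ + D * (x₂ * x₂)) * (y₁ * y₁ - D * (y₂ * y₂) + (y₁ * y₁ - D * (y₂ * y₂))))
        ≡ 0ℚ
    in-coordinates = solve-∀ ℚ-ring

  N-nonNeg : ∀ u → 0ℚ ≤ N u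
  N-nonNeg (u₁ +√-d· u₂) = ℚ.+-mono-≤ (square-nonNeg u₁) (*-nonNeg (ℤ→ℚ-nonNeg d) (square-nonNeg u₂))

  N≡0⇒≡0K : 0 ℕ.< d → ∀ u → N u ≡ 0ℚ → u ≡ 0K
  N≡0⇒≡0K 0<d (u₁ +√-d· u₂) N≡0 = cong₂ _+√-d·_
    (decidable-stable (u₁ ℚ.≟ 0ℚ) λ u₁≢0 →
      ℚ.<⇒≢ (ℚ.+-mono-<-≤ (square-pos u₁≢0) (*-nonNeg (ℤ→ℚ-nonNeg d) (square-nonNeg u₂))) (sym N≡0))
    (decidable-stable (u₂ ℚ.≟ 0ℚ) λ u₂≢0 →
      ℚ.<⇒≢ (ℚ.+-mono-≤-< (square-nonNeg u₁) (*-pos (ℤ→ℚ-pos 0<d) (square-pos u₂≢0))) (sym N≡0))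

  -- The ring of integers

  IsIntegerℚ-+ : ∀ {p q} → IsIntegerℚ p → IsIntegerℚ q → IsIntegerℚ (p + q)
  IsIntegerℚ-+ (m , refl) (n , refl) = m ℤ.+ n , sym (ℤ→ℚ-+ m n)

  IsIntegerℚ-* : ∀ {p q} → IsIntegerℚ p → IsIntegerℚ q → IsIntegerℚ (p * q)
  IsIntegerℚ-* (m , refl) (n , refl) = m ℤ.* n , sym (ℤ→ℚ-* m n)

  IsIntegerℚ-neg : ∀ {p} → IsIntegerℚ p → IsIntegerℚ (- p)
  IsIntegerℚ-neg (m , refl) = ℤ.- m , sym (ℤ→ℚ-neg m)

  IsIntegerℚ-monic-root : ∀ {T b c} → IsIntegerℚ b → IsIntegerℚ c → T * T + b * T + c ≡ 0ℚ → IsIntegerℚ T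
  IsIntegerℚ-monic-root {T} (m , refl) (n , refl) = monic-quadratic-root-integral T m n

  In𝒪-0K : In𝒪 0K
  In𝒪-0K = (ℤ.+ 0 , refl) , (ℤ.+ 0 , N-0K)

  In𝒪-1K : In𝒪 1K
  In𝒪-1K = (ℤ.+ 2 , refl) , (ℤ.+ 1 , N-1K)

  In𝒪-⊝ : ∀ u → In𝒪 u → In𝒪 (⊝ u)
  In𝒪-⊝ u (Tr∈ , N∈) = subst IsIntegerℚ (sym (Tr-⊝ u)) (IsIntegerℚ-neg Tr∈) , subst IsIntegerℚ (sym (N-⊝ u)) N∈

  In𝒪-conj : ∀ u → In𝒪 u → In𝒪 (conj u)
  In𝒪-conj u (Tr∈ , N∈) = Tr∈ , subst IsIntegerℚ (sym (N-conj u)) N∈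

  In𝒪-⊗ : ∀ x y → In𝒪 x → In𝒪 y → In𝒪 (x ⊗ y)
  In𝒪-⊗ x y x∈@(Trx∈ , Nx∈) y∈@(Try∈ , Ny∈) = Tr∈ , subst IsIntegerℚ (sym (N-⊗ x y)) (IsIntegerℚ-* Nx∈ Ny∈)
    where
    Tr-square∈ : ∀ u → In𝒪 u → IsIntegerℚ (Tr (u ⊗ u))
    Tr-square∈ u (Tru∈ , Nu∈) = subst IsIntegerℚ (sym (Tr-⊗-self u))
      (IsIntegerℚ-+ (IsIntegerℚ-* Tru∈ Tru∈) (IsIntegerℚ-neg (IsIntegerℚ-+ Nu∈ Nu∈)))
    Tr∈ : IsIntegerℚ (Tr (x ⊗ y))
    Tr∈ = IsIntegerℚ-monic-root (IsIntegerℚ-neg (IsIntegerℚ-* Trx∈ Try∈))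
      (IsIntegerℚ-+ (IsIntegerℚ-* Ny∈ (Tr-square∈ x x∈)) (IsIntegerℚ-* Nx∈ (Tr-square∈ y y∈)))
      (Tr-⊗-root x y)

  In𝒪-⊕ : ∀ u v → In𝒪 u → In𝒪 v → In𝒪 (u ⊕ v)
  In𝒪-⊕ u v u∈@(Tru∈ , Nu∈) v∈@(Trv∈ , Nv∈) =
    subst IsIntegerℚ (sym (Tr-⊕ u v)) (IsIntegerℚ-+ Tru∈ Trv∈) ,
    subst IsIntegerℚ (sym (N-⊕ u v)) (IsIntegerℚ-+ (IsIntegerℚ-+ Nu∈ Nv∈) (proj₁ (In𝒪-⊗ u (conj v) u∈ (In𝒪-conj v v∈))))

  -- Two elements of SL(2, 𝒪_d)

  -- 1 + (x, y)ᵀ (−y, x), the parabolic element fixing the cusp x/y.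
  parabolic : ∀ x y → In𝒪 x → In𝒪 y → SL2
  parabolic x y x∈ y∈ = record
    { α = 1K ⊖ x ⊗ y ; β = x ⊗ x ; γ = ⊝ (y ⊗ y) ; δ = 1K ⊕ x ⊗ y
    ; α∈ = In𝒪-⊕ 1K (⊝ (x ⊗ y)) In𝒪-1K (In𝒪-⊝ (x ⊗ y) xy∈)
    ; β∈ = In𝒪-⊗ x x x∈ x∈
    ; γ∈ = In𝒪-⊝ (y ⊗ y) (In𝒪-⊗ y y y∈ y∈)
    ; δ∈ = In𝒪-⊕ 1K (x ⊗ y) In𝒪-1K xy∈
    ; det≡1 = det x y
    }
    where
    xy∈ : In𝒪 (x ⊗ y)
    xy∈ = In𝒪-⊗ x y x∈ y∈
    det : ∀ x y → (1K ⊖ x ⊗ y) ⊗ (1K ⊕ x ⊗ y) ⊕ ι (- 1ℚ) ⊗ (x ⊗ x ⊗ ⊝ (y ⊗ y)) ≡ 1K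
    det (x₁ +√-d· x₂) (y₁ +√-d· y₂) = cong₂ _+√-d·_ (re-part dℚ x₁ x₂ y₁ y₂) (im-part dℚ x₁ x₂ y₁ y₂)
      where
      re-part :
        ∀ D x₁ x₂ y₁ y₂ →
          (1ℚ + - (x₁ * y₁ - D * (x₂ * y₂))) * (1ℚ + (x₁ * y₁ - D * (x₂ * y₂)))
              - D * ((0ℚ + - (x₁ * y₂ + x₂ * y₁)) * (0ℚ + (x₁ * y₂ + x₂ * y₁)))
              + (- 1ℚ * ((x₁ * x₁ - D * (x₂ * x₂)) * - (y₁ * y₁ - D * (y₂ * y₂)) - D * ((x₁ * x₂ + x₂ * x₁) * - (y₁ * y₂ + y₂ * y₁))) - D * (0ℚ * ((x₁ * x₁ - D * (x₂ * x₂)) * - (y₁ * y₂ + y₂ * y₁) + (x₁ * x₂ + x₂ * x₁) * - (y₁ * y₁ - D * (y₂ * y₂)))))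
          ≡ 1ℚ
      re-part = solve-∀ ℚ-ring
      im-part :
        ∀ D x₁ x₂ y₁ y₂ →
          (1ℚ + - (x₁ * y₁ - D * (x₂ * y₂))) * (0ℚ + (x₁ * y₂ + x₂ * y₁))
              + (0ℚ + - (x₁ * y₂ + x₂ * y₁)) * (1ℚ + (x₁ * y₁ - D * (x₂ * y₂)))
              + (- 1ℚ * ((x₁ * x₁ - D * (x₂ * x₂)) * - (y₁ * y₂ + y₂ * y₁) + (x₁ * x₂ + x₂ * x₁) * - (y₁ * y₁ - D * (y₂ * y₂))) + 0ℚ * ((x₁ * x₁ - D * (x₂ * x₂)) * - (y₁ * y₁ - D * (y₂ * y₂)) - D * ((x₁ * x₂ + x₂ * x₁) * - (y₁ * y₂ + y₂ * y₁))))
          ≡ 0ℚ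
      im-part = solve-∀ ℚ-ring

  translation : ∀ w → In𝒪 w → SL2
  translation w w∈ = record
    { α = 1K ; β = w ; γ = 0K ; δ = 1K
    ; α∈ = In𝒪-1K ; β∈ = w∈ ; γ∈ = In𝒪-0K ; δ∈ = In𝒪-1K
    ; det≡1 = det w
    }
    where
    det : ∀ w → 1K ⊗ 1K ⊕ ι (- 1ℚ) ⊗ (w ⊗ 0K) ≡ 1K
    det (w₁ +√-d· w₂) = cong₂ _+√-d·_ (re-part dℚ w₁ w₂) (im-part dℚ w₁ w₂)
      where
      re-part :
        ∀ D w₁ w₂ →
          1ℚ * 1ℚ - D * (0ℚ * 0ℚ) + (- 1ℚ * (w₁ * 0ℚ - D * (w₂ * 0ℚ)) - D * (0ℚ * (w₁ * 0ℚ + w₂ * 0ℚ)))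
          ≡ 1ℚ
      re-part = solve-∀ ℚ-ring
      im-part : ∀ D w₁ w₂ → 1ℚ * 0ℚ + 0ℚ * 1ℚ + (- 1ℚ * (w₁ * 0ℚ + w₂ * 0ℚ) + 0ℚ * (w₁ * 0ℚ - D * (w₂ * 0ℚ))) ≡ 0ℚ
      im-part = solve-∀ ℚ-ring

  cross≡-det : ∀ α β γ δ z → (α ⊗ z ⊕ β) ⊗ γ ⊖ α ⊗ (γ ⊗ z ⊕ δ) ≡ ⊝ (α ⊗ δ ⊕ ι (- 1ℚ) ⊗ (β ⊗ γ))
  cross≡-det (α₁ +√-d· α₂) (β₁ +√-d· β₂) (γ₁ +√-d· γ₂) (δ₁ +√-d· δ₂) (z₁ +√-d· z₂) =
    cong₂ _+√-d·_ (re-part dℚ α₁ α₂ β₁ β₂ γ₁ γ₂ δ₁ δ₂ z₁ z₂) (im-part dℚ α₁ α₂ β₁ β₂ γ₁ γ₂ δ₁ δ₂ z₁ z₂)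
    where
    re-part :
      ∀ D α₁ α₂ β₁ β₂ γ₁ γ₂ δ₁ δ₂ z₁ z₂ →
        (α₁ * z₁ - D * (α₂ * z₂) + β₁) * γ₁
            - D * ((α₁ * z₂ + α₂ * z₁ + β₂) * γ₂)
            + - (α₁ * (γ₁ * z₁ - D * (γ₂ * z₂) + δ₁) - D * (α₂ * (γ₁ * z₂ + γ₂ * z₁ + δ₂)))
        ≡ - (α₁ * δ₁ - D * (α₂ * δ₂) + (- 1ℚ * (β₁ * γ₁ - D * (β₂ * γ₂)) - D * (0ℚ * (β₁ * γ₂ + β₂ * γ₁))))
    re-part = solve-∀ ℚ-ring
    im-part :
      ∀ D α₁ α₂ β₁ β₂ γ₁ γ₂ δ₁ δ₂ z₁ z₂ →
        (α₁ * z₁ - D * (α₂ * z₂) + β₁) * γ₂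
            + (α₁ * z₂ + α₂ * z₁ + β₂) * γ₁
            + - (α₁ * (γ₁ * z₂ + γ₂ * z₁ + δ₂) + α₂ * (γ₁ * z₁ - D * (γ₂ * z₂) + δ₁))
        ≡ - (α₁ * δ₂ + α₂ * δ₁ + (- 1ℚ * (β₁ * γ₂ + β₂ * γ₁) + 0ℚ * (β₁ * γ₁ - D * (β₂ * γ₂))))
    im-part = solve-∀ ℚ-ring

  numerator-norm : ∀ w w′ α γ s →
    N (w ⊗ conj w′ ⊕ α ⊗ conj γ ⊗ ι s) + s * N (w ⊗ γ ⊖ α ⊗ w′) ≡ (N w′ + N γ * s) * (N w + N α * s)
  numerator-norm (w₁ +√-d· w₂) (w′₁ +√-d· w′₂) (α₁ +√-d· α₂) (γ₁ +√-d· γ₂) s =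
    in-coordinates dℚ w₁ w₂ w′₁ w′₂ α₁ α₂ γ₁ γ₂ s
    where
    in-coordinates :
      ∀ D w₁ w₂ w′₁ w′₂ α₁ α₂ γ₁ γ₂ s →
        (w₁ * w′₁ - D * (w₂ * - w′₂) + ((α₁ * γ₁ - D * (α₂ * - γ₂)) * s - D * ((α₁ * - γ₂ + α₂ * γ₁) * 0ℚ))) * (w₁ * w′₁ - D * (w₂ * - w′₂) + ((α₁ * γ₁ - D * (α₂ * - γ₂)) * s - D * ((α₁ * - γ₂ + α₂ * γ₁) * 0ℚ)))
            + D * ((w₁ * - w′₂ + w₂ * w′₁ + ((α₁ * γ₁ - D * (α₂ * - γ₂)) * 0ℚ + (α₁ * - γ₂ + α₂ * γ₁) * s)) * (w₁ * - w′₂ + w₂ * w′₁ + ((α₁ * γ₁ - D * (α₂ * - γ₂)) * 0ℚ + (α₁ * - γ₂ + α₂ * γ₁) * s)))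
            + s * ((w₁ * γ₁ - D * (w₂ * γ₂) + - (α₁ * w′₁ - D * (α₂ * w′₂))) * (w₁ * γ₁ - D * (w₂ * γ₂) + - (α₁ * w′₁ - D * (α₂ * w′₂))) + D * ((w₁ * γ₂ + w₂ * γ₁ + - (α₁ * w′₂ + α₂ * w′₁)) * (w₁ * γ₂ + w₂ * γ₁ + - (α₁ * w′₂ + α₂ * w′₁))))
        ≡ (w′₁ * w′₁ + D * (w′₂ * w′₂) + (γ₁ * γ₁ + D * (γ₂ * γ₂)) * s) * (w₁ * w₁ + D * (w₂ * w₂) + (α₁ * α₁ + D * (α₂ * α₂)) * s)
    in-coordinates = solve-∀ ℚ-ring

  Tr-numerator : ∀ B w w′ α γ s →
    Tr (B ⊗ (w ⊗ conj w′ ⊕ α ⊗ conj γ ⊗ ι s)) ≡ Tr (w ⊗ B ⊗ conj w′) + s * Tr (α ⊗ B ⊗ conj γ)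
  Tr-numerator (B₁ +√-d· B₂) (w₁ +√-d· w₂) (w′₁ +√-d· w′₂) (α₁ +√-d· α₂) (γ₁ +√-d· γ₂) s =
    in-coordinates dℚ B₁ B₂ w₁ w₂ w′₁ w′₂ α₁ α₂ γ₁ γ₂ s
    where
    in-coordinates :
      ∀ D B₁ B₂ w₁ w₂ w′₁ w′₂ α₁ α₂ γ₁ γ₂ s →
        B₁ * (w₁ * w′₁ - D * (w₂ * - w′₂) + ((α₁ * γ₁ - D * (α₂ * - γ₂)) * s - D * ((α₁ * - γ₂ + α₂ * γ₁) * 0ℚ)))
            - D * (B₂ * (w₁ * - w′₂ + w₂ * w′₁ + ((α₁ * γ₁ - D * (α₂ * - γ₂)) * 0ℚ + (α₁ * - γ₂ + α₂ * γ₁) * s)))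
            + (B₁ * (w₁ * w′₁ - D * (w₂ * - w′₂) + ((α₁ * γ₁ - D * (α₂ * - γ₂)) * s - D * ((α₁ * - γ₂ + α₂ * γ₁) * 0ℚ))) - D * (B₂ * (w₁ * - w′₂ + w₂ * w′₁ + ((α₁ * γ₁ - D * (α₂ * - γ₂)) * 0ℚ + (α₁ * - γ₂ + α₂ * γ₁) * s))))
        ≡ (w₁ * B₁ - D * (w₂ * B₂)) * w′₁
            - D * ((w₁ * B₂ + w₂ * B₁) * - w′₂)
            + ((w₁ * B₁ - D * (w₂ * B₂)) * w′₁ - D * ((w₁ * B₂ + w₂ * B₁) * - w′₂))
            + s * ((α₁ * B₁ - D * (α₂ * B₂)) * γ₁ - D * ((α₁ * B₂ + α₂ * B₁) * - γ₂) + ((α₁ * B₁ - D * (α₂ * B₂)) * γ₁ - D * ((α₁ * B₂ + α₂ * B₁) * - γ₂)))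
    in-coordinates = solve-∀ ℚ-ring

  parabolic-row₁ : ∀ x y z → y ⊗ ((1K ⊖ x ⊗ y) ⊗ z ⊕ x ⊗ x) ≡ (1K ⊕ y ⊗ (x ⊖ y ⊗ z)) ⊗ x ⊖ (x ⊖ y ⊗ z)
  parabolic-row₁ (x₁ +√-d· x₂) (y₁ +√-d· y₂) (z₁ +√-d· z₂) =
    cong₂ _+√-d·_ (re-part dℚ x₁ x₂ y₁ y₂ z₁ z₂) (im-part dℚ x₁ x₂ y₁ y₂ z₁ z₂)
    where
    re-part :
      ∀ D x₁ x₂ y₁ y₂ z₁ z₂ →
        y₁ * ((1ℚ + - (x₁ * y₁ - D * (x₂ * y₂))) * z₁ - D * ((0ℚ + - (x₁ * y₂ + x₂ * y₁)) * z₂) + (x₁ * x₁ - D * (x₂ * x₂)))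
            - D * (y₂ * ((1ℚ + - (x₁ * y₁ - D * (x₂ * y₂))) * z₂ + (0ℚ + - (x₁ * y₂ + x₂ * y₁)) * z₁ + (x₁ * x₂ + x₂ * x₁)))
        ≡ (1ℚ + (y₁ * (x₁ + - (y₁ * z₁ - D * (y₂ * z₂))) - D * (y₂ * (x₂ + - (y₁ * z₂ + y₂ * z₁))))) * x₁
            - D * ((0ℚ + (y₁ * (x₂ + - (y₁ * z₂ + y₂ * z₁)) + y₂ * (x₁ + - (y₁ * z₁ - D * (y₂ * z₂))))) * x₂)
            + - (x₁ + - (y₁ * z₁ - D * (y₂ * z₂)))
    re-part = solve-∀ ℚ-ring
    im-part :
      ∀ D x₁ x₂ y₁ y₂ z₁ z₂ →
        y₁ * ((1ℚ + - (x₁ * y₁ - D * (x₂ * y₂))) * z₂ + (0ℚ + - (x₁ * y₂ + x₂ * y₁)) * z₁ + (x₁ * x₂ + x₂ * x₁))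
            + y₂ * ((1ℚ + - (x₁ * y₁ - D * (x₂ * y₂))) * z₁ - D * ((0ℚ + - (x₁ * y₂ + x₂ * y₁)) * z₂) + (x₁ * x₁ - D * (x₂ * x₂)))
        ≡ (1ℚ + (y₁ * (x₁ + - (y₁ * z₁ - D * (y₂ * z₂))) - D * (y₂ * (x₂ + - (y₁ * z₂ + y₂ * z₁))))) * x₂
            + (0ℚ + (y₁ * (x₂ + - (y₁ * z₂ + y₂ * z₁)) + y₂ * (x₁ + - (y₁ * z₁ - D * (y₂ * z₂))))) * x₁
            + - (x₂ + - (y₁ * z₂ + y₂ * z₁))
    im-part = solve-∀ ℚ-ring

  parabolic-row₂ : ∀ x y z → y ⊗ (⊝ (y ⊗ y) ⊗ z ⊕ (1K ⊕ x ⊗ y)) ≡ (1K ⊕ y ⊗ (x ⊖ y ⊗ z)) ⊗ y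
  parabolic-row₂ (x₁ +√-d· x₂) (y₁ +√-d· y₂) (z₁ +√-d· z₂) =
    cong₂ _+√-d·_ (re-part dℚ x₁ x₂ y₁ y₂ z₁ z₂) (im-part dℚ x₁ x₂ y₁ y₂ z₁ z₂)
    where
    re-part :
      ∀ D x₁ x₂ y₁ y₂ z₁ z₂ →
        y₁ * (- (y₁ * y₁ - D * (y₂ * y₂)) * z₁ - D * (- (y₁ * y₂ + y₂ * y₁) * z₂) + (1ℚ + (x₁ * y₁ - D * (x₂ * y₂))))
            - D * (y₂ * (- (y₁ * y₁ - D * (y₂ * y₂)) * z₂ + - (y₁ * y₂ + y₂ * y₁) * z₁ + (0ℚ + (x₁ * y₂ + x₂ * y₁))))
        ≡ (1ℚ + (y₁ * (x₁ + - (y₁ * z₁ - D * (y₂ * z₂))) - D * (y₂ * (x₂ + - (y₁ * z₂ + y₂ * z₁))))) * y₁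
            - D * ((0ℚ + (y₁ * (x₂ + - (y₁ * z₂ + y₂ * z₁)) + y₂ * (x₁ + - (y₁ * z₁ - D * (y₂ * z₂))))) * y₂)
    re-part = solve-∀ ℚ-ring
    im-part :
      ∀ D x₁ x₂ y₁ y₂ z₁ z₂ →
        y₁ * (- (y₁ * y₁ - D * (y₂ * y₂)) * z₂ + - (y₁ * y₂ + y₂ * y₁) * z₁ + (0ℚ + (x₁ * y₂ + x₂ * y₁)))
            + y₂ * (- (y₁ * y₁ - D * (y₂ * y₂)) * z₁ - D * (- (y₁ * y₂ + y₂ * y₁) * z₂) + (1ℚ + (x₁ * y₁ - D * (x₂ * y₂))))
        ≡ (1ℚ + (y₁ * (x₁ + - (y₁ * z₁ - D * (y₂ * z₂))) - D * (y₂ * (x₂ + - (y₁ * z₂ + y₂ * z₁))))) * y₂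
            + (0ℚ + (y₁ * (x₂ + - (y₁ * z₂ + y₂ * z₁)) + y₂ * (x₁ + - (y₁ * z₁ - D * (y₂ * z₂))))) * y₁
    im-part = solve-∀ ℚ-ring

  ⊗-1K : ∀ u → u ⊗ 1K ≡ u
  ⊗-1K (u₁ +√-d· u₂) = cong₂ _+√-d·_ (re-part dℚ u₁ u₂) (im-part dℚ u₁ u₂)
    where
    re-part : ∀ D u₁ u₂ → u₁ * 1ℚ - D * (u₂ * 0ℚ) ≡ u₁
    re-part = solve-∀ ℚ-ring
    im-part : ∀ D u₁ u₂ → u₁ * 0ℚ + u₂ * 1ℚ ≡ u₂
    im-part = solve-∀ ℚ-ring

  1K-⊗ : ∀ u → 1K ⊗ u ≡ u
  1K-⊗ (u₁ +√-d· u₂) = cong₂ _+√-d·_ (re-part dℚ u₁ u₂) (im-part dℚ u₁ u₂)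
    where
    re-part : ∀ D u₁ u₂ → 1ℚ * u₁ - D * (0ℚ * u₂) ≡ u₁
    re-part = solve-∀ ℚ-ring
    im-part : ∀ D u₁ u₂ → 1ℚ * u₂ + 0ℚ * u₁ ≡ u₂
    im-part = solve-∀ ℚ-ring

  ι-⊗-ι : ∀ p r u → ι p ⊗ (ι r ⊗ u) ≡ ι (p * r) ⊗ u
  ι-⊗-ι p r (u₁ +√-d· u₂) = cong₂ _+√-d·_ (re-part dℚ p r u₁ u₂) (im-part dℚ p r u₁ u₂)
    where
    re-part :
      ∀ D p r u₁ u₂ →
        p * (r * u₁ - D * (0ℚ * u₂)) - D * (0ℚ * (r * u₂ + 0ℚ * u₁))
        ≡ p * r * u₁ - D * (0ℚ * u₂)
    re-part = solve-∀ ℚ-ring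
    im-part : ∀ D p r u₁ u₂ → p * (r * u₂ + 0ℚ * u₁) + 0ℚ * (r * u₁ - D * (0ℚ * u₂)) ≡ p * r * u₂ + 0ℚ * u₁
    im-part = solve-∀ ℚ-ring

  ⊖-⊕-cancel : ∀ u v → u ⊖ v ⊕ v ≡ u
  ⊖-⊕-cancel (u₁ +√-d· u₂) (v₁ +√-d· v₂) = cong₂ _+√-d·_ (re-part dℚ u₁ u₂ v₁ v₂) (im-part dℚ u₁ u₂ v₁ v₂)
    where
    re-part : ∀ D u₁ u₂ v₁ v₂ → u₁ + - v₁ + v₁ ≡ u₁
    re-part = solve-∀ ℚ-ring
    im-part : ∀ D u₁ u₂ v₁ v₂ → u₂ + - v₂ + v₂ ≡ u₂
    im-part = solve-∀ ℚ-ring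

  ⊖-⊖-cancel : ∀ u v → u ⊖ (u ⊖ v) ≡ v
  ⊖-⊖-cancel (u₁ +√-d· u₂) (v₁ +√-d· v₂) = cong₂ _+√-d·_ (re-part dℚ u₁ u₂ v₁ v₂) (im-part dℚ u₁ u₂ v₁ v₂)
    where
    re-part : ∀ D u₁ u₂ v₁ v₂ → u₁ + - (u₁ + - v₁) ≡ v₁
    re-part = solve-∀ ℚ-ring
    im-part : ∀ D u₁ u₂ v₁ v₂ → u₂ + - (u₂ + - v₂) ≡ v₂
    im-part = solve-∀ ℚ-ring

  ⊗-⊕-regroup : ∀ t z w b → t ⊗ (z ⊕ w) ⊕ b ≡ t ⊗ z ⊕ b ⊕ t ⊗ w
  ⊗-⊕-regroup (t₁ +√-d· t₂) (z₁ +√-d· z₂) (w₁ +√-d· w₂) (b₁ +√-d· b₂) =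
    cong₂ _+√-d·_ (re-part dℚ t₁ t₂ z₁ z₂ w₁ w₂ b₁ b₂) (im-part dℚ t₁ t₂ z₁ z₂ w₁ w₂ b₁ b₂)
    where
    re-part :
      ∀ D t₁ t₂ z₁ z₂ w₁ w₂ b₁ b₂ →
        t₁ * (z₁ + w₁) - D * (t₂ * (z₂ + w₂)) + b₁
        ≡ t₁ * z₁ - D * (t₂ * z₂) + b₁ + (t₁ * w₁ - D * (t₂ * w₂))
    re-part = solve-∀ ℚ-ring
    im-part :
      ∀ D t₁ t₂ z₁ z₂ w₁ w₂ b₁ b₂ →
        t₁ * (z₂ + w₂) + t₂ * (z₁ + w₁) + b₂
        ≡ t₁ * z₂ + t₂ * z₁ + b₂ + (t₁ * w₂ + t₂ * w₁)
    im-part = solve-∀ ℚ-ring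

  ⊗-ι-conj-⊗ : ∀ y r u → y ⊗ (ι r ⊗ (conj y ⊗ u)) ≡ ι (N y * r) ⊗ u
  ⊗-ι-conj-⊗ (y₁ +√-d· y₂) r (u₁ +√-d· u₂) = cong₂ _+√-d·_ (re-part dℚ r y₁ y₂ u₁ u₂) (im-part dℚ r y₁ y₂ u₁ u₂)
    where
    re-part :
      ∀ D r y₁ y₂ u₁ u₂ →
        y₁ * (r * (y₁ * u₁ - D * (- y₂ * u₂)) - D * (0ℚ * (y₁ * u₂ + - y₂ * u₁)))
            - D * (y₂ * (r * (y₁ * u₂ + - y₂ * u₁) + 0ℚ * (y₁ * u₁ - D * (- y₂ * u₂))))
        ≡ (y₁ * y₁ + D * (y₂ * y₂)) * r * u₁ - D * (0ℚ * u₂)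
    re-part = solve-∀ ℚ-ring
    im-part :
      ∀ D r y₁ y₂ u₁ u₂ →
        y₁ * (r * (y₁ * u₂ + - y₂ * u₁) + 0ℚ * (y₁ * u₁ - D * (- y₂ * u₂)))
            + y₂ * (r * (y₁ * u₁ - D * (- y₂ * u₂)) - D * (0ℚ * (y₁ * u₂ + - y₂ * u₁)))
        ≡ (y₁ * y₁ + D * (y₂ * y₂)) * r * u₂ + 0ℚ * u₁
    im-part = solve-∀ ℚ-ring

  N-ι-⊗ : ∀ r u → N (ι r ⊗ u) ≡ r * r * N u
  N-ι-⊗ r (u₁ +√-d· u₂) = in-coordinates dℚ r u₁ u₂
    where
    in-coordinates :
      ∀ D r u₁ u₂ →
        (r * u₁ - D * (0ℚ * u₂)) * (r * u₁ - D * (0ℚ * u₂)) + D * ((r * u₂ + 0ℚ * u₁) * (r * u₂ + 0ℚ * u₁))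
        ≡ r * r * (u₁ * u₁ + D * (u₂ * u₂))
    in-coordinates = solve-∀ ℚ-ring

  N-ι-⊗-square : ∀ p x → N (ι p ⊗ (x ⊗ x)) ≡ p * N x * (p * N x)
  N-ι-⊗-square p (x₁ +√-d· x₂) = in-coordinates dℚ p x₁ x₂
    where
    in-coordinates :
      ∀ D p x₁ x₂ →
        (p * (x₁ * x₁ - D * (x₂ * x₂)) - D * (0ℚ * (x₁ * x₂ + x₂ * x₁))) * (p * (x₁ * x₁ - D * (x₂ * x₂)) - D * (0ℚ * (x₁ * x₂ + x₂ * x₁)))
            + D * ((p * (x₁ * x₂ + x₂ * x₁) + 0ℚ * (x₁ * x₁ - D * (x₂ * x₂))) * (p * (x₁ * x₂ + x₂ * x₁) + 0ℚ * (x₁ * x₁ - D * (x₂ * x₂))))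
        ≡ p * (x₁ * x₁ + D * (x₂ * x₂)) * (p * (x₁ * x₁ + D * (x₂ * x₂)))
    in-coordinates = solve-∀ ℚ-ring

  N-ι-⊗-square-⊕ : ∀ p r x → N (ι p ⊗ (x ⊗ x) ⊕ ι r ⊗ (x ⊗ x)) ≡ (p + r) * N x * ((p + r) * N x)
  N-ι-⊗-square-⊕ p r (x₁ +√-d· x₂) = in-coordinates dℚ p r x₁ x₂
    where
    in-coordinates :
      ∀ D p r x₁ x₂ →
        (p * (x₁ * x₁ - D * (x₂ * x₂)) - D * (0ℚ * (x₁ * x₂ + x₂ * x₁)) + (r * (x₁ * x₁ - D * (x₂ * x₂)) - D * (0ℚ * (x₁ * x₂ + x₂ * x₁)))) * (p * (x₁ * x₁ - D * (x₂ * x₂)) - D * (0ℚ * (x₁ * x₂ + x₂ * x₁)) + (r * (x₁ * x₁ - D * (x₂ * x₂)) - D * (0ℚ * (x₁ * x₂ + x₂ * x₁))))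
            + D * ((p * (x₁ * x₂ + x₂ * x₁) + 0ℚ * (x₁ * x₁ - D * (x₂ * x₂)) + (r * (x₁ * x₂ + x₂ * x₁) + 0ℚ * (x₁ * x₁ - D * (x₂ * x₂)))) * (p * (x₁ * x₂ + x₂ * x₁) + 0ℚ * (x₁ * x₁ - D * (x₂ * x₂)) + (r * (x₁ * x₂ + x₂ * x₁) + 0ℚ * (x₁ * x₁ - D * (x₂ * x₂)))))
        ≡ (p + r) * (x₁ * x₁ + D * (x₂ * x₂)) * ((p + r) * (x₁ * x₁ + D * (x₂ * x₂)))
    in-coordinates = solve-∀ ℚ-ring

  N-1K⊕ : ∀ y e → N (1K ⊕ y ⊗ e) ≡ 1ℚ + Tr (y ⊗ e) + N y * N e
  N-1K⊕ (y₁ +√-d· y₂) (e₁ +√-d· e₂) = in-coordinates dℚ y₁ y₂ e₁ e₂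
    where
    in-coordinates :
      ∀ D y₁ y₂ e₁ e₂ →
        (1ℚ + (y₁ * e₁ - D * (y₂ * e₂))) * (1ℚ + (y₁ * e₁ - D * (y₂ * e₂)))
            + D * ((0ℚ + (y₁ * e₂ + y₂ * e₁)) * (0ℚ + (y₁ * e₂ + y₂ * e₁)))
        ≡ 1ℚ
            + (y₁ * e₁ - D * (y₂ * e₂) + (y₁ * e₁ - D * (y₂ * e₂)))
            + (y₁ * y₁ + D * (y₂ * y₂)) * (e₁ * e₁ + D * (e₂ * e₂))
    in-coordinates = solve-∀ ℚ-ring

  Tr-conj-1K⊕ : ∀ y e k → Tr (conj e ⊗ ((1K ⊕ y ⊗ e) ⊗ k)) ≡ Tr (conj e ⊗ k) + N e * Tr (y ⊗ k)
  Tr-conj-1K⊕ (y₁ +√-d· y₂) (e₁ +√-d· e₂) (k₁ +√-d· k₂) = in-coordinates dℚ y₁ y₂ e₁ e₂ k₁ k₂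
    where
    in-coordinates :
      ∀ D y₁ y₂ e₁ e₂ k₁ k₂ →
        e₁ * ((1ℚ + (y₁ * e₁ - D * (y₂ * e₂))) * k₁ - D * ((0ℚ + (y₁ * e₂ + y₂ * e₁)) * k₂))
            - D * (- e₂ * ((1ℚ + (y₁ * e₁ - D * (y₂ * e₂))) * k₂ + (0ℚ + (y₁ * e₂ + y₂ * e₁)) * k₁))
            + (e₁ * ((1ℚ + (y₁ * e₁ - D * (y₂ * e₂))) * k₁ - D * ((0ℚ + (y₁ * e₂ + y₂ * e₁)) * k₂)) - D * (- e₂ * ((1ℚ + (y₁ * e₁ - D * (y₂ * e₂))) * k₂ + (0ℚ + (y₁ * e₂ + y₂ * e₁)) * k₁)))
        ≡ e₁ * k₁
            - D * (- e₂ * k₂)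
            + (e₁ * k₁ - D * (- e₂ * k₂))
            + (e₁ * e₁ + D * (e₂ * e₂)) * (y₁ * k₁ - D * (y₂ * k₂) + (y₁ * k₁ - D * (y₂ * k₂)))
    in-coordinates = solve-∀ ℚ-ring

  N-shift : ∀ h k y → N (k ⊖ ι h ⊗ conj y) ≡ N k - h * Tr (y ⊗ k) + h * h * N y
  N-shift h (k₁ +√-d· k₂) (y₁ +√-d· y₂) = in-coordinates dℚ h k₁ k₂ y₁ y₂
    where
    in-coordinates :
      ∀ D h k₁ k₂ y₁ y₂ →
        (k₁ + - (h * y₁ - D * (0ℚ * - y₂))) * (k₁ + - (h * y₁ - D * (0ℚ * - y₂)))
            + D * ((k₂ + - (h * - y₂ + 0ℚ * y₁)) * (k₂ + - (h * - y₂ + 0ℚ * y₁)))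
        ≡ k₁ * k₁
            + D * (k₂ * k₂)
            - h * (y₁ * k₁ - D * (y₂ * k₂) + (y₁ * k₁ - D * (y₂ * k₂)))
            + h * h * (y₁ * y₁ + D * (y₂ * y₂))
    in-coordinates = solve-∀ ℚ-ring

  Tr-conj-shift : ∀ h l k y → Tr (conj (ι l ⊗ (k ⊖ ι h ⊗ conj y)) ⊗ k) ≡ l * (N k + N k - h * Tr (y ⊗ k))
  Tr-conj-shift h l (k₁ +√-d· k₂) (y₁ +√-d· y₂) = in-coordinates dℚ h l k₁ k₂ y₁ y₂
    where
    in-coordinates :
      ∀ D h l k₁ k₂ y₁ y₂ →
        (l * (k₁ + - (h * y₁ - D * (0ℚ * - y₂))) - D * (0ℚ * (k₂ + - (h * - y₂ + 0ℚ * y₁)))) * k₁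
            - D * (- (l * (k₂ + - (h * - y₂ + 0ℚ * y₁)) + 0ℚ * (k₁ + - (h * y₁ - D * (0ℚ * - y₂)))) * k₂)
            + ((l * (k₁ + - (h * y₁ - D * (0ℚ * - y₂))) - D * (0ℚ * (k₂ + - (h * - y₂ + 0ℚ * y₁)))) * k₁ - D * (- (l * (k₂ + - (h * - y₂ + 0ℚ * y₁)) + 0ℚ * (k₁ + - (h * y₁ - D * (0ℚ * - y₂)))) * k₂))
        ≡ l * (k₁ * k₁ + D * (k₂ * k₂) + (k₁ * k₁ + D * (k₂ * k₂)) - h * (y₁ * k₁ - D * (y₂ * k₂) + (y₁ * k₁ - D * (y₂ * k₂))))
    in-coordinates = solve-∀ ℚ-ring

  Tr-shift : ∀ h l k y → Tr (y ⊗ (ι l ⊗ (k ⊖ ι h ⊗ conj y))) ≡ l * (Tr (y ⊗ k) - h * (N y + N y))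
  Tr-shift h l (k₁ +√-d· k₂) (y₁ +√-d· y₂) = in-coordinates dℚ h l k₁ k₂ y₁ y₂
    where
    in-coordinates :
      ∀ D h l k₁ k₂ y₁ y₂ →
        y₁ * (l * (k₁ + - (h * y₁ - D * (0ℚ * - y₂))) - D * (0ℚ * (k₂ + - (h * - y₂ + 0ℚ * y₁))))
            - D * (y₂ * (l * (k₂ + - (h * - y₂ + 0ℚ * y₁)) + 0ℚ * (k₁ + - (h * y₁ - D * (0ℚ * - y₂)))))
            + (y₁ * (l * (k₁ + - (h * y₁ - D * (0ℚ * - y₂))) - D * (0ℚ * (k₂ + - (h * - y₂ + 0ℚ * y₁)))) - D * (y₂ * (l * (k₂ + - (h * - y₂ + 0ℚ * y₁)) + 0ℚ * (k₁ + - (h * y₁ - D * (0ℚ * - y₂))))))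
        ≡ l * (y₁ * k₁ - D * (y₂ * k₂) + (y₁ * k₁ - D * (y₂ * k₂)) - h * (y₁ * y₁ + D * (y₂ * y₂) + (y₁ * y₁ + D * (y₂ * y₂))))
    in-coordinates = solve-∀ ℚ-ring

  -- The plane H_A and its images

  module _ (a c : ℤ) (B : K) where

    -- The plane equation of g⁻¹ H_A, whose Hermitian form is (u, v) ↦ Q_A (g (u, v)ᵀ).
    pullback-plane-eq : SL2 → K → ℚ → ℚ
    pullback-plane-eq g z s = QA a B c (α ⊗ z ⊕ β) (γ ⊗ z ⊕ δ) + s * QA a B c α γ
      where open SL2 g

    ∈H-image⇔ : ∀ g p → (g · p ∈H[ a , B , c ]) ⇔ (pullback-plane-eq g (Pt.z p) (Pt.s p) ≡ 0ℚ)
    ∈H-image⇔ g p = mk⇔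
      (λ image∈H → *-cancelˡ-≡ Nd≢0 (trans (sym scaled) (trans image∈H (sym (ℚ.*-zeroʳ Nd)))))
      (λ G≡0 → trans scaled (trans (cong (Nd *_) G≡0) (ℚ.*-zeroʳ Nd)))
      where
      open SL2 g
      A : ℚ
      A = ℤ→ℚ a
      C : ℚ
      C = ℤ→ℚ c
      z : K
      z = Pt.z p
      s : ℚ
      s = Pt.s p
      w : K
      w = α ⊗ z ⊕ β
      w′ : K
      w′ = γ ⊗ z ⊕ δ
      X : K
      X = w ⊗ conj w′ ⊕ α ⊗ conj γ ⊗ ι s
      Nd : ℚ
      Nd = N w′ + N γ * s

      N-numerator : N X + s ≡ Nd * (N w + N α * s)
      N-numerator = begin
        N X + s                           ≡⟨ cong (λ t → N X + t) (ℚ.*-identityʳ s) ⟨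
        N X + s * 1ℚ                      ≡⟨ cong (λ t → N X + s * t) N-cross ⟨
        N X + s * N (w ⊗ γ ⊖ α ⊗ w′)      ≡⟨ numerator-norm w w′ α γ s ⟩
        Nd * (N w + N α * s)              ∎
        where
        open ≡-Reasoning
        N-cross : N (w ⊗ γ ⊖ α ⊗ w′) ≡ 1ℚ
        N-cross = trans (cong N (cross≡-det α β γ δ z))
          (trans (N-⊝ (α ⊗ δ ⊕ ι (- 1ℚ) ⊗ (β ⊗ γ))) (trans (cong N det≡1) N-1K))

      Nd≢0 : Nd ≢ 0ℚ
      Nd≢0 Nd≡0 = ℚ.<⇒≢ (ℚ.+-mono-≤-< (N-nonNeg X) (Pt.s>0 p))
        (sym (trans N-numerator (trans (cong (_* (N w + N α * s)) Nd≡0) (ℚ.*-zeroˡ (N w + N α * s)))))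

      scaled : A * (N X + s) + Nd * Tr (B ⊗ X) + C * (Nd * Nd) ≡ Nd * pullback-plane-eq g z s
      scaled = begin
        A * (N X + s) + Nd * Tr (B ⊗ X) + C * (Nd * Nd)
          ≡⟨ cong₂ (λ n t → A * n + Nd * t + C * (Nd * Nd)) N-numerator (Tr-numerator B w w′ α γ s) ⟩
        A * (Nd * (N w + N α * s)) + Nd * (Tr (w ⊗ B ⊗ conj w′) + s * Tr (α ⊗ B ⊗ conj γ)) + C * (Nd * Nd)
          ≡⟨ collect A C (N w) (N w′) (N α) (N γ) (Tr (w ⊗ B ⊗ conj w′)) (Tr (α ⊗ B ⊗ conj γ)) s ⟩
        Nd * pullback-plane-eq g z s ∎
        where
        open ≡-Reasoning
        collect : ∀ A C n n′ nα nγ t t′ s →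
          A * ((n′ + nγ * s) * (n + nα * s)) + (n′ + nγ * s) * (t + s * t′) + C * ((n′ + nγ * s) * (n′ + nγ * s))
          ≡ (n′ + nγ * s) * (A * n + t + C * n′ + s * (A * nα + t′ + C * nγ))
        collect = solve-∀ ℚ-ring

    moves∧keeps⇒¬Embedded : ∀ g p p′ →
      p ∈H[ a , B , c ] → pullback-plane-eq g (Pt.z p) (Pt.s p) ≢ 0ℚ →
      p′ ∈H[ a , B , c ] → pullback-plane-eq g (Pt.z p′) (Pt.s p′) ≡ 0ℚ →
      ¬ Embedded a B c
    moves∧keeps⇒¬Embedded g p p′ p∈H moved p′∈H kept embedded =
      [ (λ preserves → moved (Equivalence.to (∈H-image⇔ g p) (Equivalence.to (preserves p) p∈H)))
      , (λ disjoint → disjoint (p′ , p′∈H , Equivalence.from (∈H-image⇔ g p′) kept))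
      ]′ (embedded g)

    SplitFamily : SL2 → ℚ → Set
    SplitFamily g q = ∀ h → 0ℚ < Disc a B c - h * h →
      Σ Pt λ p → p ∈H[ a , B , c ] × Σ ℚ λ μ → μ ≢ 0ℚ × pullback-plane-eq g (Pt.z p) (Pt.s p) ≡ μ * (q - (h + h))

    SplitFamily⇒¬Embedded : ∀ g q → SplitFamily g q → q ≢ 0ℚ →
      0ℚ < Disc a B c → 0ℚ < Disc a B c - q * ½ * (q * ½) → ¬ Embedded a B c
    SplitFamily⇒¬Embedded g q family q≢0 0<D 0<D-¼q² =
      let p , p∈H , μ , μ≢0 , G≡μq = family 0ℚ (subst (0ℚ <_) (sym (ℚ.+-identityʳ D)) 0<D)
          p′ , p′∈H , μ′ , _ , G′≡μ′0 = family (q * ½) 0<D-¼q²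
      in moves∧keeps⇒¬Embedded g p p′
           p∈H (λ G≡0 → p*q≢0 μ≢0 q≢0 (trans (sym (trans G≡μq (cong (μ *_) (ℚ.+-identityʳ q)))) G≡0))
           p′∈H (trans G′≡μ′0 (trans (cong (μ′ *_) (halves q)) (ℚ.*-zeroʳ μ′)))
      where
      D : ℚ
      D = Disc a B c
      halves : ∀ q → q - (q * ½ + q * ½) ≡ 0ℚ
      halves = solve-∀ ℚ-ring

    -- κ u v is the first entry of the row vector (u v) A.
    κ : K → K → K
    κ u v = ι (ℤ→ℚ a) ⊗ u ⊕ conj B ⊗ v

    plane-eq≡QA : ∀ z s → plane-eq a B c z s ≡ QA a B c z 1K + ℤ→ℚ a * s
    plane-eq≡QA (z₁ +√-d· z₂) s = in-coordinates dℚ (ℤ→ℚ a) (ℤ→ℚ c) (re B) (im B) z₁ z₂ s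
      where
      in-coordinates :
        ∀ D A C B₁ B₂ z₁ z₂ s →
          A * (z₁ * z₁ + D * (z₂ * z₂) + s) + (B₁ * z₁ - D * (B₂ * z₂) + (B₁ * z₁ - D * (B₂ * z₂))) + C
          ≡ A * (z₁ * z₁ + D * (z₂ * z₂))
              + ((z₁ * B₁ - D * (z₂ * B₂)) * 1ℚ - D * ((z₁ * B₂ + z₂ * B₁) * - 0ℚ) + ((z₁ * B₁ - D * (z₂ * B₂)) * 1ℚ - D * ((z₁ * B₂ + z₂ * B₁) * - 0ℚ)))
              + C * (1ℚ * 1ℚ + D * (0ℚ * 0ℚ))
              + A * s
      in-coordinates = solve-∀ ℚ-ring

    QA-scale : ∀ t u v → QA a B c (t ⊗ u) (t ⊗ v) ≡ N t * QA a B c u v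
    QA-scale (t₁ +√-d· t₂) (u₁ +√-d· u₂) (v₁ +√-d· v₂) =
      in-coordinates dℚ (ℤ→ℚ a) (ℤ→ℚ c) (re B) (im B) t₁ t₂ u₁ u₂ v₁ v₂
      where
      in-coordinates :
        ∀ D A C B₁ B₂ t₁ t₂ u₁ u₂ v₁ v₂ →
          A * ((t₁ * u₁ - D * (t₂ * u₂)) * (t₁ * u₁ - D * (t₂ * u₂)) + D * ((t₁ * u₂ + t₂ * u₁) * (t₁ * u₂ + t₂ * u₁)))
              + (((t₁ * u₁ - D * (t₂ * u₂)) * B₁ - D * ((t₁ * u₂ + t₂ * u₁) * B₂)) * (t₁ * v₁ - D * (t₂ * v₂)) - D * (((t₁ * u₁ - D * (t₂ * u₂)) * B₂ + (t₁ * u₂ + t₂ * u₁) * B₁) * - (t₁ * v₂ + t₂ * v₁)) + (((t₁ * u₁ - D * (t₂ * u₂)) * B₁ - D * ((t₁ * u₂ + t₂ * u₁) * B₂)) * (t₁ * v₁ - D * (t₂ * v₂)) - D * (((t₁ * u₁ - D * (t₂ * u₂)) * B₂ + (t₁ * u₂ + t₂ * u₁) * B₁) * - (t₁ * v₂ + t₂ * v₁))))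
              + C * ((t₁ * v₁ - D * (t₂ * v₂)) * (t₁ * v₁ - D * (t₂ * v₂)) + D * ((t₁ * v₂ + t₂ * v₁) * (t₁ * v₂ + t₂ * v₁)))
          ≡ (t₁ * t₁ + D * (t₂ * t₂)) * (A * (u₁ * u₁ + D * (u₂ * u₂)) + ((u₁ * B₁ - D * (u₂ * B₂)) * v₁ - D * ((u₁ * B₂ + u₂ * B₁) * - v₂) + ((u₁ * B₁ - D * (u₂ * B₂)) * v₁ - D * ((u₁ * B₂ + u₂ * B₁) * - v₂))) + C * (v₁ * v₁ + D * (v₂ * v₂)))
      in-coordinates = solve-∀ ℚ-ring

    QA-⊖ˡ : ∀ u v e → QA a B c (u ⊖ e) v ≡ QA a B c u v - Tr (conj e ⊗ κ u v) + ℤ→ℚ a * N e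
    QA-⊖ˡ (u₁ +√-d· u₂) (v₁ +√-d· v₂) (e₁ +√-d· e₂) =
      in-coordinates dℚ (ℤ→ℚ a) (ℤ→ℚ c) (re B) (im B) u₁ u₂ v₁ v₂ e₁ e₂
      where
      in-coordinates :
        ∀ D A C B₁ B₂ u₁ u₂ v₁ v₂ e₁ e₂ →
          A * ((u₁ + - e₁) * (u₁ + - e₁) + D * ((u₂ + - e₂) * (u₂ + - e₂)))
              + (((u₁ + - e₁) * B₁ - D * ((u₂ + - e₂) * B₂)) * v₁ - D * (((u₁ + - e₁) * B₂ + (u₂ + - e₂) * B₁) * - v₂) + (((u₁ + - e₁) * B₁ - D * ((u₂ + - e₂) * B₂)) * v₁ - D * (((u₁ + - e₁) * B₂ + (u₂ + - e₂) * B₁) * - v₂)))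
              + C * (v₁ * v₁ + D * (v₂ * v₂))
          ≡ A * (u₁ * u₁ + D * (u₂ * u₂))
              + ((u₁ * B₁ - D * (u₂ * B₂)) * v₁ - D * ((u₁ * B₂ + u₂ * B₁) * - v₂) + ((u₁ * B₁ - D * (u₂ * B₂)) * v₁ - D * ((u₁ * B₂ + u₂ * B₁) * - v₂)))
              + C * (v₁ * v₁ + D * (v₂ * v₂))
              - (e₁ * (A * u₁ - D * (0ℚ * u₂) + (B₁ * v₁ - D * (- B₂ * v₂))) - D * (- e₂ * (A * u₂ + 0ℚ * u₁ + (B₁ * v₂ + - B₂ * v₁))) + (e₁ * (A * u₁ - D * (0ℚ * u₂) + (B₁ * v₁ - D * (- B₂ * v₂))) - D * (- e₂ * (A * u₂ + 0ℚ * u₁ + (B₁ * v₂ + - B₂ * v₁)))))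
              + A * (e₁ * e₁ + D * (e₂ * e₂))
      in-coordinates = solve-∀ ℚ-ring

    κ-scale : ∀ t u v → κ (t ⊗ u) (t ⊗ v) ≡ t ⊗ κ u v
    κ-scale (t₁ +√-d· t₂) (u₁ +√-d· u₂) (v₁ +√-d· v₂) =
      cong₂ _+√-d·_ (re-part dℚ (ℤ→ℚ a) (re B) (im B) t₁ t₂ u₁ u₂ v₁ v₂) (im-part dℚ (ℤ→ℚ a) (re B) (im B) t₁ t₂ u₁ u₂ v₁ v₂)
      where
      re-part :
        ∀ D A B₁ B₂ t₁ t₂ u₁ u₂ v₁ v₂ →
          A * (t₁ * u₁ - D * (t₂ * u₂))
              - D * (0ℚ * (t₁ * u₂ + t₂ * u₁))
              + (B₁ * (t₁ * v₁ - D * (t₂ * v₂)) - D * (- B₂ * (t₁ * v₂ + t₂ * v₁)))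
          ≡ t₁ * (A * u₁ - D * (0ℚ * u₂) + (B₁ * v₁ - D * (- B₂ * v₂)))
              - D * (t₂ * (A * u₂ + 0ℚ * u₁ + (B₁ * v₂ + - B₂ * v₁)))
      re-part = solve-∀ ℚ-ring
      im-part :
        ∀ D A B₁ B₂ t₁ t₂ u₁ u₂ v₁ v₂ →
          A * (t₁ * u₂ + t₂ * u₁)
              + 0ℚ * (t₁ * u₁ - D * (t₂ * u₂))
              + (B₁ * (t₁ * v₂ + t₂ * v₁) + - B₂ * (t₁ * v₁ - D * (t₂ * v₂)))
          ≡ t₁ * (A * u₂ + 0ℚ * u₁ + (B₁ * v₂ + - B₂ * v₁))
              + t₂ * (A * u₁ - D * (0ℚ * u₂) + (B₁ * v₁ - D * (- B₂ * v₂)))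
      im-part = solve-∀ ℚ-ring

    N-κ : ∀ u v → N (κ u v) ≡ ℤ→ℚ a * QA a B c u v + N v * Disc a B c
    N-κ (u₁ +√-d· u₂) (v₁ +√-d· v₂) = in-coordinates dℚ (ℤ→ℚ a) (ℤ→ℚ c) (re B) (im B) u₁ u₂ v₁ v₂
      where
      in-coordinates :
        ∀ D A C B₁ B₂ u₁ u₂ v₁ v₂ →
          (A * u₁ - D * (0ℚ * u₂) + (B₁ * v₁ - D * (- B₂ * v₂))) * (A * u₁ - D * (0ℚ * u₂) + (B₁ * v₁ - D * (- B₂ * v₂)))
              + D * ((A * u₂ + 0ℚ * u₁ + (B₁ * v₂ + - B₂ * v₁)) * (A * u₂ + 0ℚ * u₁ + (B₁ * v₂ + - B₂ * v₁)))
          ≡ A * (A * (u₁ * u₁ + D * (u₂ * u₂)) + ((u₁ * B₁ - D * (u₂ * B₂)) * v₁ - D * ((u₁ * B₂ + u₂ * B₁) * - v₂) + ((u₁ * B₁ - D * (u₂ * B₂)) * v₁ - D * ((u₁ * B₂ + u₂ * B₁) * - v₂))) + C * (v₁ * v₁ + D * (v₂ * v₂)))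
              + (v₁ * v₁ + D * (v₂ * v₂)) * (B₁ * B₁ + D * (B₂ * B₂) - A * C)
      in-coordinates = solve-∀ ℚ-ring

    QA-parabolic-column : ∀ x y → QA a B c (1K ⊖ x ⊗ y) (⊝ (y ⊗ y)) ≡ ℤ→ℚ a + N y * QA a B c x y - Tr (y ⊗ κ x y)
    QA-parabolic-column (x₁ +√-d· x₂) (y₁ +√-d· y₂) = in-coordinates dℚ (ℤ→ℚ a) (ℤ→ℚ c) (re B) (im B) x₁ x₂ y₁ y₂
      where
      in-coordinates :
        ∀ D A C B₁ B₂ x₁ x₂ y₁ y₂ →
          A * ((1ℚ + - (x₁ * y₁ - D * (x₂ * y₂))) * (1ℚ + - (x₁ * y₁ - D * (x₂ * y₂))) + D * ((0ℚ + - (x₁ * y₂ + x₂ * y₁)) * (0ℚ + - (x₁ * y₂ + x₂ * y₁))))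
              + (((1ℚ + - (x₁ * y₁ - D * (x₂ * y₂))) * B₁ - D * ((0ℚ + - (x₁ * y₂ + x₂ * y₁)) * B₂)) * - (y₁ * y₁ - D * (y₂ * y₂)) - D * (((1ℚ + - (x₁ * y₁ - D * (x₂ * y₂))) * B₂ + (0ℚ + - (x₁ * y₂ + x₂ * y₁)) * B₁) * - (- (y₁ * y₂ + y₂ * y₁))) + (((1ℚ + - (x₁ * y₁ - D * (x₂ * y₂))) * B₁ - D * ((0ℚ + - (x₁ * y₂ + x₂ * y₁)) * B₂)) * - (y₁ * y₁ - D * (y₂ * y₂)) - D * (((1ℚ + - (x₁ * y₁ - D * (x₂ * y₂))) * B₂ + (0ℚ + - (x₁ * y₂ + x₂ * y₁)) * B₁) * - (- (y₁ * y₂ + y₂ * y₁)))))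
              + C * (- (y₁ * y₁ - D * (y₂ * y₂)) * - (y₁ * y₁ - D * (y₂ * y₂)) + D * (- (y₁ * y₂ + y₂ * y₁) * - (y₁ * y₂ + y₂ * y₁)))
          ≡ A
              + (y₁ * y₁ + D * (y₂ * y₂)) * (A * (x₁ * x₁ + D * (x₂ * x₂)) + ((x₁ * B₁ - D * (x₂ * B₂)) * y₁ - D * ((x₁ * B₂ + x₂ * B₁) * - y₂) + ((x₁ * B₁ - D * (x₂ * B₂)) * y₁ - D * ((x₁ * B₂ + x₂ * B₁) * - y₂))) + C * (y₁ * y₁ + D * (y₂ * y₂)))
              - (y₁ * (A * x₁ - D * (0ℚ * x₂) + (B₁ * y₁ - D * (- B₂ * y₂))) - D * (y₂ * (A * x₂ + 0ℚ * x₁ + (B₁ * y₂ + - B₂ * y₁))) + (y₁ * (A * x₁ - D * (0ℚ * x₂) + (B₁ * y₁ - D * (- B₂ * y₂))) - D * (y₂ * (A * x₂ + 0ℚ * x₁ + (B₁ * y₂ + - B₂ * y₁)))))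
      in-coordinates = solve-∀ ℚ-ring

    pullback-translation : ∀ w w∈ z s → pullback-plane-eq (translation w w∈) z s ≡ plane-eq a B c (z ⊕ w) s
    pullback-translation (w₁ +√-d· w₂) _ (z₁ +√-d· z₂) s =
      in-coordinates dℚ (ℤ→ℚ a) (ℤ→ℚ c) (re B) (im B) w₁ w₂ z₁ z₂ s
      where
      in-coordinates :
        ∀ D A C B₁ B₂ w₁ w₂ z₁ z₂ s →
          A * ((1ℚ * z₁ - D * (0ℚ * z₂) + w₁) * (1ℚ * z₁ - D * (0ℚ * z₂) + w₁) + D * ((1ℚ * z₂ + 0ℚ * z₁ + w₂) * (1ℚ * z₂ + 0ℚ * z₁ + w₂)))
              + (((1ℚ * z₁ - D * (0ℚ * z₂) + w₁) * B₁ - D * ((1ℚ * z₂ + 0ℚ * z₁ + w₂) * B₂)) * (0ℚ * z₁ - D * (0ℚ * z₂) + 1ℚ) - D * (((1ℚ * z₁ - D * (0ℚ * z₂) + w₁) * B₂ + (1ℚ * z₂ + 0ℚ * z₁ + w₂) * B₁) * - (0ℚ * z₂ + 0ℚ * z₁ + 0ℚ)) + (((1ℚ * z₁ - D * (0ℚ * z₂) + w₁) * B₁ - D * ((1ℚ * z₂ + 0ℚ * z₁ + w₂) * B₂)) * (0ℚ * z₁ - D * (0ℚ * z₂) + 1ℚ) - D * (((1ℚ * z₁ - D * (0ℚ * z₂) + w₁) * B₂ + (1ℚ * z₂ + 0ℚ * z₁ + w₂) * B₁) * - (0ℚ * z₂ + 0ℚ * z₁ + 0ℚ))))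
              + C * ((0ℚ * z₁ - D * (0ℚ * z₂) + 1ℚ) * (0ℚ * z₁ - D * (0ℚ * z₂) + 1ℚ) + D * ((0ℚ * z₂ + 0ℚ * z₁ + 0ℚ) * (0ℚ * z₂ + 0ℚ * z₁ + 0ℚ)))
              + s * (A * (1ℚ * 1ℚ + D * (0ℚ * 0ℚ)) + ((1ℚ * B₁ - D * (0ℚ * B₂)) * 0ℚ - D * ((1ℚ * B₂ + 0ℚ * B₁) * - 0ℚ) + ((1ℚ * B₁ - D * (0ℚ * B₂)) * 0ℚ - D * ((1ℚ * B₂ + 0ℚ * B₁) * - 0ℚ))) + C * (0ℚ * 0ℚ + D * (0ℚ * 0ℚ)))
          ≡ A * ((z₁ + w₁) * (z₁ + w₁) + D * ((z₂ + w₂) * (z₂ + w₂)) + s)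
              + (B₁ * (z₁ + w₁) - D * (B₂ * (z₂ + w₂)) + (B₁ * (z₁ + w₁) - D * (B₂ * (z₂ + w₂))))
              + C
      in-coordinates = solve-∀ ℚ-ring

    completing-square : ∀ z s → ℤ→ℚ a * plane-eq a B c z s ≡ N (ι (ℤ→ℚ a) ⊗ z ⊕ conj B) + ℤ→ℚ a * ℤ→ℚ a * s - Disc a B c
    completing-square (z₁ +√-d· z₂) s = in-coordinates dℚ (ℤ→ℚ a) (ℤ→ℚ c) (re B) (im B) z₁ z₂ s
      where
      in-coordinates :
        ∀ D A C B₁ B₂ z₁ z₂ s →
          A * (A * (z₁ * z₁ + D * (z₂ * z₂) + s) + (B₁ * z₁ - D * (B₂ * z₂) + (B₁ * z₁ - D * (B₂ * z₂))) + C)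
          ≡ (A * z₁ - D * (0ℚ * z₂) + B₁) * (A * z₁ - D * (0ℚ * z₂) + B₁)
              + D * ((A * z₂ + 0ℚ * z₁ + - B₂) * (A * z₂ + 0ℚ * z₁ + - B₂))
              + A * A * s
              - (B₁ * B₁ + D * (B₂ * B₂) - A * C)
      in-coordinates = solve-∀ ℚ-ring

    QA-0K : ∀ x → QA a B c x 0K ≡ ℤ→ℚ a * N x
    QA-0K (x₁ +√-d· x₂) = in-coordinates dℚ (ℤ→ℚ a) (ℤ→ℚ c) (re B) (im B) x₁ x₂
      where
      in-coordinates :
        ∀ D A C B₁ B₂ x₁ x₂ →
          A * (x₁ * x₁ + D * (x₂ * x₂))
              + ((x₁ * B₁ - D * (x₂ * B₂)) * 0ℚ - D * ((x₁ * B₂ + x₂ * B₁) * - 0ℚ) + ((x₁ * B₁ - D * (x₂ * B₂)) * 0ℚ - D * ((x₁ * B₂ + x₂ * B₁) * - 0ℚ)))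
              + C * (0ℚ * 0ℚ + D * (0ℚ * 0ℚ))
          ≡ A * (x₁ * x₁ + D * (x₂ * x₂))
      in-coordinates = solve-∀ ℚ-ring

    module _ (x y : K) (x∈ : In𝒪 x) (y∈ : In𝒪 y) where
      private
        A : ℚ
        A = ℤ→ℚ a
        D : ℚ
        D = Disc a B c
        q : ℚ
        q = QA a B c x y
        κ₀ : K
        κ₀ = κ x y
        ν : ℚ
        ν = N y
        τ : ℚ
        τ = Tr (y ⊗ κ₀)
        g : SL2
        g = parabolic x y x∈ y∈

        scaled-plane-eq : ∀ z s → let e = x ⊖ y ⊗ z in
          ν * plane-eq a B c z s ≡ q - Tr (conj e ⊗ κ₀) + A * (N e + ν * s)
        scaled-plane-eq z s = begin
          ν * plane-eq a B c z s                         ≡⟨ cong (ν *_) (plane-eq≡QA z s) ⟩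
          ν * (QA a B c z 1K + A * s)                    ≡⟨ ℚ.*-distribˡ-+ ν (QA a B c z 1K) (A * s) ⟩
          ν * QA a B c z 1K + ν * (A * s)                ≡⟨ cong (_+ ν * (A * s)) (QA-scale y z 1K) ⟨
          QA a B c (y ⊗ z) (y ⊗ 1K) + ν * (A * s)        ≡⟨ cong₂ (λ u v → QA a B c u v + ν * (A * s)) (sym (⊖-⊖-cancel x (y ⊗ z))) (⊗-1K y) ⟩
          QA a B c (x ⊖ e) y + ν * (A * s)               ≡⟨ cong (_+ ν * (A * s)) (QA-⊖ˡ x y e) ⟩
          q - Tr (conj e ⊗ κ₀) + A * N e + ν * (A * s)   ≡⟨ regroup q (Tr (conj e ⊗ κ₀)) A (N e) ν s ⟩
          q - Tr (conj e ⊗ κ₀) + A * (N e + ν * s)       ∎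
          where
          open ≡-Reasoning
          e : K
          e = x ⊖ y ⊗ z
          regroup : ∀ q T A n ν s → q - T + A * n + ν * (A * s) ≡ q - T + A * (n + ν * s)
          regroup = solve-∀ ℚ-ring

        scaled-pullback : ∀ z s → let e = x ⊖ y ⊗ z in
          ν * pullback-plane-eq g z s ≡ q * (1ℚ + Tr (y ⊗ e)) - Tr (conj e ⊗ κ₀) + (N e + ν * s) * (A + ν * q - τ)
        scaled-pullback z s = begin
          ν * (QA a B c w w′ + s * Qαγ)
            ≡⟨ ℚ.*-distribˡ-+ ν (QA a B c w w′) (s * Qαγ) ⟩
          ν * QA a B c w w′ + ν * (s * Qαγ)
            ≡⟨ cong₂ _+_ (sym (QA-scale y w w′)) (sym (ℚ.*-assoc ν s Qαγ)) ⟩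
          QA a B c (y ⊗ w) (y ⊗ w′) + ν * s * Qαγ
            ≡⟨ cong₂ (λ u v → QA a B c u v + ν * s * Qαγ) (parabolic-row₁ x y z) (parabolic-row₂ x y z) ⟩
          QA a B c (f ⊗ x ⊖ e) (f ⊗ y) + ν * s * Qαγ
            ≡⟨ cong₂ _+_ (QA-⊖ˡ (f ⊗ x) (f ⊗ y) e) (cong (ν * s *_) (QA-parabolic-column x y)) ⟩
          QA a B c (f ⊗ x) (f ⊗ y) - Tr (conj e ⊗ κ (f ⊗ x) (f ⊗ y)) + A * N e + ν * s * (A + ν * q - τ)
            ≡⟨ cong₂ (λ Q T → Q - T + A * N e + ν * s * (A + ν * q - τ)) (QA-scale f x y) (cong (λ k → Tr (conj e ⊗ k)) (κ-scale f x y)) ⟩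
          N f * q - Tr (conj e ⊗ (f ⊗ κ₀)) + A * N e + ν * s * (A + ν * q - τ)
            ≡⟨ cong₂ (λ n T → n * q - T + A * N e + ν * s * (A + ν * q - τ)) (N-1K⊕ y e) (Tr-conj-1K⊕ y e κ₀) ⟩
          (1ℚ + Tr (y ⊗ e) + ν * N e) * q - (Tr (conj e ⊗ κ₀) + N e * τ) + A * N e + ν * s * (A + ν * q - τ)
            ≡⟨ regroup q A ν τ (Tr (y ⊗ e)) (Tr (conj e ⊗ κ₀)) (N e) s ⟩
          q * (1ℚ + Tr (y ⊗ e)) - Tr (conj e ⊗ κ₀) + (N e + ν * s) * (A + ν * q - τ) ∎
          where
          open ≡-Reasoning
          e : K
          e = x ⊖ y ⊗ z
          f : K
          f = 1K ⊕ y ⊗ e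
          w : K
          w = (1K ⊖ x ⊗ y) ⊗ z ⊕ x ⊗ x
          w′ : K
          w′ = ⊝ (y ⊗ y) ⊗ z ⊕ (1K ⊕ x ⊗ y)
          Qαγ : ℚ
          Qαγ = QA a B c (1K ⊖ x ⊗ y) (⊝ (y ⊗ y))
          regroup : ∀ q A ν τ t T n s →
            (1ℚ + t + ν * n) * q - (T + n * τ) + A * n + ν * s * (A + ν * q - τ)
            ≡ q * (1ℚ + t) - T + (n + ν * s) * (A + ν * q - τ)
          regroup = solve-∀ ℚ-ring

      -- With e = x − y z, N y times either plane equation is affine in e and in N e + N y · s. The point has
      -- e = l (κ₀ − h ȳ) for the real l with l Δ = q, and s chosen so that N e + N y · s = l q.
      private
        module ParabolicPoint (ν≢0 : N y ≢ 0ℚ) (q≢0 : q ≢ 0ℚ) (h : ℚ) (0<D-h² : 0ℚ < D - h * h) where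
          w : K
          w = κ₀ ⊖ ι h ⊗ conj y
          Δ : ℚ
          Δ = N κ₀ - h * τ + ν * D
          Δ≡ : N w + ν * (D - h * h) ≡ Δ
          Δ≡ = trans (cong (_+ ν * (D - h * h)) (N-shift h κ₀ y)) (collect (N κ₀) h τ ν D)
            where
            collect : ∀ n h τ ν D → n - h * τ + h * h * ν + ν * (D - h * h) ≡ n - h * τ + ν * D
            collect = solve-∀ ℚ-ring
          0<Δ : 0ℚ < Δ
          0<Δ = subst (0ℚ <_) Δ≡ (ℚ.+-mono-≤-< (N-nonNeg w) (*-pos (nonNeg∧≢0⇒pos (N-nonNeg y) ν≢0) 0<D-h²))
          instance
            Δ-nonZero : NonZero Δ
            Δ-nonZero = ℚ.pos⇒nonZero Δ {{ℚ.positive 0<Δ}}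
            ν-nonZero : NonZero ν
            ν-nonZero = ≢-nonZero ν≢0
          l : ℚ
          l = q ÷ Δ
          lΔ≡q : l * Δ ≡ q
          lΔ≡q = ÷-*-cancel q Δ
          l≢0 : l ≢ 0ℚ
          l≢0 l≡0 = q≢0 (trans (sym lΔ≡q) (trans (cong (_* Δ) l≡0) (ℚ.*-zeroˡ Δ)))

          e : K
          e = ι l ⊗ w
          z : K
          z = ι (1/ ν) ⊗ (conj y ⊗ (x ⊖ e))
          s : ℚ
          s = l * l * (D - h * h)
          p : Pt
          p = record { z = z ; s = s ; s>0 = *-pos (square-pos l≢0) 0<D-h² }

          e≡ : x ⊖ y ⊗ z ≡ e
          e≡ = begin
            x ⊖ y ⊗ z                    ≡⟨ cong (x ⊖_) (⊗-ι-conj-⊗ y (1/ ν) (x ⊖ e)) ⟩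
            x ⊖ ι (ν * 1/ ν) ⊗ (x ⊖ e)   ≡⟨ cong (λ r → x ⊖ ι r ⊗ (x ⊖ e)) (ℚ.*-inverseʳ ν) ⟩
            x ⊖ 1K ⊗ (x ⊖ e)             ≡⟨ cong (x ⊖_) (1K-⊗ (x ⊖ e)) ⟩
            x ⊖ (x ⊖ e)                  ≡⟨ ⊖-⊖-cancel x e ⟩
            e                            ∎
            where open ≡-Reasoning

          N-e≡ : N e + ν * s ≡ l * q
          N-e≡ = begin
            N e + ν * s                                                    ≡⟨ cong (_+ ν * s) (trans (N-ι-⊗ l w) (cong (l * l *_) (N-shift h κ₀ y))) ⟩
            l * l * (N κ₀ - h * τ + h * h * ν) + ν * (l * l * (D - h * h))  ≡⟨ collect l (N κ₀) h τ ν D ⟩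
            l * (l * Δ)                                                    ≡⟨ cong (l *_) lΔ≡q ⟩
            l * q                                                          ∎
            where
            open ≡-Reasoning
            collect : ∀ l n h τ ν D → l * l * (n - h * τ + h * h * ν) + ν * (l * l * (D - h * h)) ≡ l * (l * (n - h * τ + ν * D))
            collect = solve-∀ ℚ-ring

          plane-value : q - l * (N κ₀ + N κ₀ - h * τ) + A * (l * q) ≡ 0ℚ
          plane-value = begin
            q - l * (N κ₀ + N κ₀ - h * τ) + A * (l * q)   ≡⟨ split q l (N κ₀) h τ A ν D ⟩
            (q - l * Δ) - l * (N κ₀ - (A * q + ν * D))    ≡⟨ cong₂ (λ r t → r - l * t) (trans (cong (λ t → q - t) lΔ≡q) (ℚ.+-inverseʳ q))
                                                                (trans (cong (_- (A * q + ν * D)) (N-κ x y)) (ℚ.+-inverseʳ (A * q + ν * D))) ⟩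
            0ℚ - l * 0ℚ                                   ≡⟨ vanish l ⟩
            0ℚ                                            ∎
            where
            open ≡-Reasoning
            split : ∀ q l n h τ A ν D → q - l * (n + n - h * τ) + A * (l * q) ≡ (q - l * (n - h * τ + ν * D)) - l * (n - (A * q + ν * D))
            split = solve-∀ ℚ-ring
            vanish : ∀ l → 0ℚ - l * 0ℚ ≡ 0ℚ
            vanish = solve-∀ ℚ-ring

          p∈H : p ∈H[ a , B , c ]
          p∈H = *-cancelˡ-≡ ν≢0 (begin
            ν * plane-eq a B c z s                                ≡⟨ scaled-plane-eq z s ⟩
            q - Tr (conj (x ⊖ y ⊗ z) ⊗ κ₀) + A * (N (x ⊖ y ⊗ z) + ν * s)
              ≡⟨ cong (λ e → q - Tr (conj e ⊗ κ₀) + A * (N e + ν * s)) e≡ ⟩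
            q - Tr (conj e ⊗ κ₀) + A * (N e + ν * s)              ≡⟨ cong₂ (λ T M → q - T + A * M) (Tr-conj-shift h l κ₀ y) N-e≡ ⟩
            q - l * (N κ₀ + N κ₀ - h * τ) + A * (l * q)           ≡⟨ plane-value ⟩
            0ℚ                                                    ≡⟨ ℚ.*-zeroʳ ν ⟨
            ν * 0ℚ                                                ∎)
            where open ≡-Reasoning

          pullback≡ : pullback-plane-eq g z s ≡ l * q * (q - (h + h))
          pullback≡ = *-cancelˡ-≡ ν≢0 (begin
            ν * pullback-plane-eq g z s                           ≡⟨ scaled-pullback z s ⟩
            q * (1ℚ + Tr (y ⊗ (x ⊖ y ⊗ z))) - Tr (conj (x ⊖ y ⊗ z) ⊗ κ₀) + (N (x ⊖ y ⊗ z) + ν * s) * (A + ν * q - τ)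
              ≡⟨ cong (λ e → q * (1ℚ + Tr (y ⊗ e)) - Tr (conj e ⊗ κ₀) + (N e + ν * s) * (A + ν * q - τ)) e≡ ⟩
            q * (1ℚ + Tr (y ⊗ e)) - Tr (conj e ⊗ κ₀) + (N e + ν * s) * (A + ν * q - τ)
              ≡⟨ cong₂ (λ t M → q * (1ℚ + t) - Tr (conj e ⊗ κ₀) + M * (A + ν * q - τ)) (Tr-shift h l κ₀ y) N-e≡ ⟩
            q * (1ℚ + l * (τ - h * (ν + ν))) - Tr (conj e ⊗ κ₀) + l * q * (A + ν * q - τ)
              ≡⟨ cong (λ T → q * (1ℚ + l * (τ - h * (ν + ν))) - T + l * q * (A + ν * q - τ)) (Tr-conj-shift h l κ₀ y) ⟩
            q * (1ℚ + l * (τ - h * (ν + ν))) - l * (N κ₀ + N κ₀ - h * τ) + l * q * (A + ν * q - τ)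
              ≡⟨ split q l (N κ₀) h τ A ν ⟩
            (q - l * (N κ₀ + N κ₀ - h * τ) + A * (l * q)) + ν * (l * q * (q - (h + h)))
              ≡⟨ cong (_+ ν * (l * q * (q - (h + h)))) plane-value ⟩
            0ℚ + ν * (l * q * (q - (h + h)))                      ≡⟨ ℚ.+-identityˡ _ ⟩
            ν * (l * q * (q - (h + h)))                           ∎)
            where
            open ≡-Reasoning
            split : ∀ q l n h τ A ν →
              q * (1ℚ + l * (τ - h * (ν + ν))) - l * (n + n - h * τ) + l * q * (A + ν * q - τ)
              ≡ (q - l * (n + n - h * τ) + A * (l * q)) + ν * (l * q * (q - (h + h)))
            split = solve-∀ ℚ-ring

      parabolic-split-family : N y ≢ 0ℚ → q ≢ 0ℚ → SplitFamily g q
      parabolic-split-family ν≢0 q≢0 h 0<D-h² = p , p∈H , l * q , p*q≢0 l≢0 q≢0 , pullback≡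
        where open ParabolicPoint ν≢0 q≢0 h 0<D-h²

    module _ (x : K) (x∈ : In𝒪 x) where
      private
        A : ℚ
        A = ℤ→ℚ a
        D : ℚ
        D = Disc a B c
        q : ℚ
        q = QA a B c x 0K
        g : SL2
        g = translation (x ⊗ x) (In𝒪-⊗ x x x∈ x∈)

      -- The point has A z + B̄ = −(h / N x) x², so that both A z + B̄ and A (z + x²) + B̄ are real multiples
      -- of x².
      private
        module TranslationPoint (q≢0 : q ≢ 0ℚ) (h : ℚ) (0<D-h² : 0ℚ < D - h * h) where
          A≢0 : A ≢ 0ℚ
          A≢0 A≡0 = q≢0 (trans (QA-0K x) (trans (cong (_* N x) A≡0) (ℚ.*-zeroˡ (N x))))
          Nx≢0 : N x ≢ 0ℚ
          Nx≢0 Nx≡0 = q≢0 (trans (QA-0K x) (trans (cong (A *_) Nx≡0) (ℚ.*-zeroʳ A)))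
          instance
            A-nonZero : NonZero A
            A-nonZero = ≢-nonZero A≢0
            Nx-nonZero : NonZero (N x)
            Nx-nonZero = ≢-nonZero Nx≢0
          t : ℚ
          t = h ÷ N x
          r : ℚ
          r = 1/ A
          r≢0 : r ≢ 0ℚ
          r≢0 r≡0 = ℚ.1≢0 (trans (sym (ℚ.*-inverseʳ A)) (trans (cong (A *_) r≡0) (ℚ.*-zeroʳ A)))
          v : K
          v = ι (- t) ⊗ (x ⊗ x)
          z : K
          z = ι r ⊗ (v ⊖ conj B)
          s : ℚ
          s = r * r * (D - h * h)
          p : Pt
          p = record { z = z ; s = s ; s>0 = *-pos (square-pos r≢0) 0<D-h² }

          centre : ι A ⊗ z ⊕ conj B ≡ v
          centre = begin
            ι A ⊗ (ι r ⊗ (v ⊖ conj B)) ⊕ conj B   ≡⟨ cong (_⊕ conj B) (ι-⊗-ι A r (v ⊖ conj B)) ⟩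
            ι (A * r) ⊗ (v ⊖ conj B) ⊕ conj B     ≡⟨ cong (λ k → ι k ⊗ (v ⊖ conj B) ⊕ conj B) (ℚ.*-inverseʳ A) ⟩
            1K ⊗ (v ⊖ conj B) ⊕ conj B            ≡⟨ cong (_⊕ conj B) (1K-⊗ (v ⊖ conj B)) ⟩
            v ⊖ conj B ⊕ conj B                   ≡⟨ ⊖-⊕-cancel v (conj B) ⟩
            v                                     ∎
            where open ≡-Reasoning

          A²s≡ : A * A * s ≡ D - h * h
          A²s≡ = begin
            A * A * (r * r * (D - h * h))     ≡⟨ regroup A r (D - h * h) ⟩
            A * r * (A * r) * (D - h * h)     ≡⟨ cong (λ k → k * k * (D - h * h)) (ℚ.*-inverseʳ A) ⟩
            1ℚ * 1ℚ * (D - h * h)             ≡⟨ ℚ.*-identityˡ (D - h * h) ⟩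
            D - h * h                         ∎
            where
            open ≡-Reasoning
            regroup : ∀ A r X → A * A * (r * r * X) ≡ A * r * (A * r) * X
            regroup = solve-∀ ℚ-ring

          tNx≡h : t * N x ≡ h
          tNx≡h = ÷-*-cancel h (N x)

          p∈H : p ∈H[ a , B , c ]
          p∈H = *-cancelˡ-≡ A≢0 (begin
            A * plane-eq a B c z s                          ≡⟨ completing-square z s ⟩
            N (ι A ⊗ z ⊕ conj B) + A * A * s - D            ≡⟨ cong₂ (λ u m → N u + m - D) centre A²s≡ ⟩
            N v + (D - h * h) - D                           ≡⟨ cong (λ n → n + (D - h * h) - D) (N-ι-⊗-square (- t) x) ⟩
            - t * N x * (- t * N x) + (D - h * h) - D       ≡⟨ regroup t (N x) h D ⟩
            t * N x * (t * N x) - h * h                     ≡⟨ cong (λ k → k * k - h * h) tNx≡h ⟩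
            h * h - h * h                                   ≡⟨ ℚ.+-inverseʳ (h * h) ⟩
            0ℚ                                              ≡⟨ ℚ.*-zeroʳ A ⟨
            A * 0ℚ                                          ∎)
            where
            open ≡-Reasoning
            regroup : ∀ t n h D → - t * n * (- t * n) + (D - h * h) - D ≡ t * n * (t * n) - h * h
            regroup = solve-∀ ℚ-ring

          pullback≡ : pullback-plane-eq g z s ≡ N x * (q - (h + h))
          pullback≡ = *-cancelˡ-≡ A≢0 (begin
            A * pullback-plane-eq g z s                     ≡⟨ cong (A *_) (pullback-translation (x ⊗ x) (In𝒪-⊗ x x x∈ x∈) z s) ⟩
            A * plane-eq a B c (z ⊕ x ⊗ x) s                ≡⟨ completing-square (z ⊕ x ⊗ x) s ⟩
            N (ι A ⊗ (z ⊕ x ⊗ x) ⊕ conj B) + A * A * s - D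
              ≡⟨ cong₂ (λ u m → N u + m - D) (trans (⊗-⊕-regroup (ι A) z (x ⊗ x) (conj B)) (cong (_⊕ ι A ⊗ (x ⊗ x)) centre)) A²s≡ ⟩
            N (v ⊕ ι A ⊗ (x ⊗ x)) + (D - h * h) - D         ≡⟨ cong (λ n → n + (D - h * h) - D) (N-ι-⊗-square-⊕ (- t) A x) ⟩
            (- t + A) * N x * ((- t + A) * N x) + (D - h * h) - D
              ≡⟨ regroup t A (N x) h D ⟩
            A * (N x * (A * N x - (t * N x + t * N x))) + (t * N x * (t * N x) - h * h)
              ≡⟨ cong (λ k → A * (N x * (A * N x - (k + k))) + (k * k - h * h)) tNx≡h ⟩
            A * (N x * (A * N x - (h + h))) + (h * h - h * h)
              ≡⟨ cong₂ (λ Q o → A * (N x * (Q - (h + h))) + o) (sym (QA-0K x)) (ℚ.+-inverseʳ (h * h)) ⟩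
            A * (N x * (q - (h + h))) + 0ℚ                  ≡⟨ ℚ.+-identityʳ _ ⟩
            A * (N x * (q - (h + h)))                       ∎)
            where
            open ≡-Reasoning
            regroup : ∀ t A n h D →
              (- t + A) * n * ((- t + A) * n) + (D - h * h) - D ≡ A * (n * (A * n - (t * n + t * n))) + (t * n * (t * n) - h * h)
            regroup = solve-∀ ℚ-ring

      translation-split-family : q ≢ 0ℚ → SplitFamily g q
      translation-split-family q≢0 h 0<D-h² = p , p∈H , N x , Nx≢0 , pullback≡
        where open TranslationPoint q≢0 h 0<D-h²

    split-family : 0 ℕ.< d → ∀ x y → In𝒪 x → In𝒪 y → QA a B c x y ≢ 0ℚ →
      Σ SL2 λ g → SplitFamily g (QA a B c x y)
    split-family 0<d x y x∈ y∈ q≢0 = by-cases (N y ℚ.≟ 0ℚ)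
      where
      at-infinity : ∀ {y} → y ≡ 0K → QA a B c x y ≢ 0ℚ → Σ SL2 λ g → SplitFamily g (QA a B c x y)
      at-infinity refl q≢0 = translation (x ⊗ x) (In𝒪-⊗ x x x∈ x∈) , translation-split-family x x∈ q≢0
      by-cases : Dec (N y ≡ 0ℚ) → Σ SL2 λ g → SplitFamily g (QA a B c x y)
      by-cases (yes ν≡0) = at-infinity (N≡0⇒≡0K 0<d y ν≡0) q≢0
      by-cases (no ν≢0)  = parabolic x y x∈ y∈ , parabolic-split-family x y x∈ y∈ ν≢0 q≢0

corollary3p5 : (d : ℕ) → 0 Data.Nat.< d → SquareFree d →
    (a c : ℤ) (B : K) → Field.In𝒪 d B →
    0ℚ < Field.Disc d a B c →
    Field.Embedded d a B c →
    ∀ (x y : K) → Field.In𝒪 d x → Field.In𝒪 d y →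
    Field.QA d a B c x y ≢ 0ℚ →
    ℤ→ℚ (Data.Integer.+ 4) * Field.Disc d a B c
      ≤ Field.QA d a B c x y * Field.QA d a B c x y
corollary3p5 d 0<d _ a c B _ 0<D embedded x y x∈ y∈ q≢0 =
  decidable-stable (ℤ→ℚ (ℤ.+ 4) * D ℚ.≤? q * q) λ 4D≰q² →
    let g , family = split-family d a c B 0<d x y x∈ y∈ q≢0
    in SplitFamily⇒¬Embedded d a c B g q family q≢0 0<D (4D≰q²⇒0<D-¼q² D q 4D≰q²) embedded
  where
  D : ℚ
  D = Field.Disc d a B c
  q : ℚ
  q = Field.QA d a B c x y
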